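{- Let $n\geq 4$ and $i_1,j_1,i_2,j_2\in[n]$ with $i_1<j_1$, $i_2<j_2$. Then (a) $\#\big({}^{i_1j_1}\mathcal{S}_n\cap\mathcal{S}_n^{i_2j_2}\big)=(n-3)!\,\chi_{i_1,j_1}\chi_{i_2,j_2}+(n-2)!\,\frac{n^2-n+2}{4}$; (b) $\#\big({}^{i_1j_1}\mathcal{S}_n\cap\mathcal{S}_n^{j_2i_2}\big)=(n-2)!\,\frac{n^2-n-2}{4}-(n-3)!\,\chi_{i_1,j_1}\chi_{i_2,j_2}$.
   Context: $\mathcal{S}_n$ is the symmetric group on $[n]$. For $p,q\in[n]$: $\mathcal{S}_n^{p\,q}=\{\sigma:\sigma(p)>\sigma(q)\}$, ${}^{p\,q}\mathcal{S}_n=\{\sigma:\sigma^{ -1}(p)>\sigma^{ -1}(q)\}$, and $\chi_{p,q}=q-p-1$. -}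

module Defs where

open import Data.Nat using (ℕ; _∸_)
open import Data.Fin using (Fin; _<_; _>_; toℕ)
open import Data.Fin.Properties using (_≟_; _<?_; all?; any?)
open import Data.Vec using (Vec; []; _∷_; lookup; tabulate)
open import Data.List using (List; [_]; map; concatMap; filter; length; allFin)
open import Data.Product using (_×_; proj₁)
open import Relation.Binary.PropositionalEquality using (_≡_)
open import Relation.Nullary using (Dec; yes; no)
open import Relation.Nullary.Decidable using (_→-dec_; _×-dec_)
open import Relation.Unary using (Pred; Decidable)

-- A permutation of [n] in one-line notation: σ(k) = lookup σ k.
-- ([n] is modelled by Fin n, i.e. 0-based; this shift preserves order and differences.)
Word : ℕ → Set
Word n = Vec (Fin n) n

IsPerm : ∀ {n} → Word n → Set
IsPerm {n} σ = ∀ (i j : Fin n) → lookup σ i ≡ lookup σ j → i ≡ j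

isPerm? : ∀ {n} (σ : Word n) → Dec (IsPerm σ)
isPerm? σ = all? (λ i → all? (λ j → (lookup σ i ≟ lookup σ j) →-dec (i ≟ j)))

allVecs : (n m : ℕ) → List (Vec (Fin n) m)
allVecs n ℕ.zero = [ [] ]
allVecs n (ℕ.suc m) = concatMap (λ x → map (x ∷_) (allVecs n m)) (allFin n)

Sn : (n : ℕ) → List (Word n)
Sn n = filter isPerm? (allVecs n n)

inv : ∀ {n} → Word n → Fin n → Fin n
inv σ p with any? (λ k → lookup σ k ≟ p)
... | yes w = proj₁ w
... | no _ = p

-- S_n^{p q} = { σ : σ(p) > σ(q) }
InDesc : ∀ {n} → Fin n → Fin n → Word n → Set
InDesc p q σ = lookup σ p > lookup σ q

-- ^{p q}S_n = { σ : σ⁻¹(p) > σ⁻¹(q) }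
InInvDesc : ∀ {n} → Fin n → Fin n → Word n → Set
InInvDesc p q σ = inv σ p > inv σ q

count : ∀ {n} {P : Pred (Word n) Agda.Primitive.lzero} → Decidable P → ℕ
count {n} P? = length (filter P? (Sn n))

#InvDesc∩Desc : ∀ {n} → (i₁ j₁ p q : Fin n) → ℕ
#InvDesc∩Desc i₁ j₁ p q =
  count {P = λ σ → InInvDesc i₁ j₁ σ × InDesc p q σ}
        (λ σ → (inv σ j₁ <? inv σ i₁) ×-dec (lookup σ q <? lookup σ p))

χ : ∀ {n} → Fin n → Fin n → ℕ
χ p q = toℕ q ∸ toℕ p ∸ 1

module Submission where

-- Write ι(σ) = [σ⁻¹(j₁) < σ⁻¹(i₁)] and δ(σ) = [σ(j₂) < σ(i₂)],
-- and let s = 2ι − 1, d = 2δ − 1 be the corresponding signs.  Pointwise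
--     4·ι·δ = 1 + s + d + d·s     and     4·ι·(1 − δ) = 1 + s − d − d·s,
-- so both counts of the theorem follow from four sums over 𝒮ₙ:
--     Σ 1 = n!,   Σ s = 0,   Σ d = 0,   Σ d·s = 2(n−2)! + 4 χ_{i₁,j₁} χ_{i₂,j₂} (n−3)!.
-- Each sum is computed by induction on n through 𝒮ₙ₊₁ ≅ [n+1] × 𝒮ₙ, σ ↦ (σ(0), standardised
-- rest), realised by 'extend v w = v ∷ (punchIn v ∘ w)': positions shift by one, values are
-- renumbered around v, and each statistic transforms by an explicit rule.

open import Defs

module Development where

  open import Data.Bool using (Bool; true; false; _∧_; not)
  import Data.Bool.Properties as BoolP
  open import Data.Fin as Fin using (Fin; zero; suc; toℕ; punchIn; punchOut)
  import Data.Fin.Properties as FinP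
  open import Data.Integer using (ℤ; +_; -_; _+_; _*_; _-_)
  import Data.Integer.Properties as ℤP
  open import Data.Integer.Tactic.RingSolver using (solve-∀)
  open import Data.List as List using (List; []; _∷_; filter; concatMap)
  open import Data.Nat as ℕ using (ℕ; zero; suc; _∸_; _!; z≤n; s≤s)
  import Data.Nat.Properties as ℕP
  open import Data.Product using (_×_; _,_; proj₁; proj₂; ∃)
  open import Data.Rational as ℚ using (_/_)
  import Data.Rational.Properties as ℚP
  open import Data.Rational.Unnormalised as ℚᵘ using (mkℚᵘ; *≡*)
  import Data.Rational.Unnormalised.Properties as ℚᵘP
  open import Data.Vec as Vec using (Vec; []; _∷_; lookup)
  import Data.Vec.Properties as VecP
  open import Function using (_∘_; id)
  open import Relation.Binary.PropositionalEquality
    using (_≡_; _≢_; refl; sym; trans; cong; cong₂; subst; subst₂; module ≡-Reasoning)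
  open import Relation.Nullary using (Dec; yes; no; does; ¬_; contradiction)
  open import Relation.Nullary.Decidable using (_×-dec_)
  open import Relation.Unary using (Pred; Decidable)

  open import Algebra.Properties.Semiring.Sum ℤP.+-*-semiring
    using (sum; sum-cong-≗; sum-remove; ∑-distrib-+; *-distribˡ-sum)

  open ≡-Reasoning

  ⟦_⟧ᵇ : Bool → ℤ
  ⟦ true ⟧ᵇ = + 1
  ⟦ false ⟧ᵇ = + 0

  ⟦_⟧ : {P : Set} → Dec P → ℤ
  ⟦ yes _ ⟧ = + 1
  ⟦ no _ ⟧ = + 0

  ⟦∧⟧ : ∀ a b → ⟦ a ∧ b ⟧ᵇ ≡ ⟦ a ⟧ᵇ * ⟦ b ⟧ᵇ
  ⟦∧⟧ true b = sym (ℤP.*-identityˡ ⟦ b ⟧ᵇ)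
  ⟦∧⟧ false b = refl

  ⟦⟧-yes : {P : Set} (d : Dec P) → P → ⟦ d ⟧ ≡ + 1
  ⟦⟧-yes (yes _) _ = refl
  ⟦⟧-yes (no ¬p) p = contradiction p ¬p

  ⟦⟧-no : {P : Set} (d : Dec P) → ¬ P → ⟦ d ⟧ ≡ + 0
  ⟦⟧-no (yes p) ¬p = contradiction p ¬p
  ⟦⟧-no (no _) _ = refl

  ⟦⟧-⇔ : {P Q : Set} (d : Dec P) (e : Dec Q) → (P → Q) → (Q → P) → ⟦ d ⟧ ≡ ⟦ e ⟧
  ⟦⟧-⇔ d (yes q) _ g = ⟦⟧-yes d (g q)
  ⟦⟧-⇔ d (no ¬q) f _ = ⟦⟧-no d (¬q ∘ f)

  ⟦<⟧-total : ∀ {n} (u v : Fin n) → u ≢ v → ⟦ v Fin.<? u ⟧ + ⟦ u Fin.<? v ⟧ ≡ + 1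
  ⟦<⟧-total u v u≢v with v Fin.<? u | u Fin.<? v
  ... | yes v<u | yes u<v = contradiction v<u (ℕP.<-asym u<v)
  ... | yes _ | no _ = refl
  ... | no _ | yes _ = refl
  ... | no v≮u | no u≮v =
    contradiction (FinP.toℕ-injective (ℕP.≤-antisym (ℕP.≮⇒≥ v≮u) (ℕP.≮⇒≥ u≮v))) u≢v

  sum-const : ∀ n c → sum {n} (λ _ → c) ≡ + n * c
  sum-const zero c = sym (ℤP.*-zeroˡ c)
  sum-const (suc n) c = begin
    c + sum {n} (λ _ → c)  ≡⟨ cong (_+_ c) (sum-const n c) ⟩
    c + + n * c            ≡⟨ factor (+ n) c ⟩
    + suc n * c            ∎
    where factor : ∀ m c → c + m * c ≡ (+ 1 + m) * c
          factor = solve-∀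

  sum-zero : ∀ n → sum {n} (λ _ → + 0) ≡ + 0
  sum-zero n = trans (sum-const n (+ 0)) (ℤP.*-zeroʳ (+ n))

  sum-scale : ∀ {n} c (f : Fin n → ℤ) → sum (λ v → c * f v) ≡ c * sum f
  sum-scale c f = sym (*-distribˡ-sum c f)

  sum-affine : ∀ {n} a b (f : Fin n → ℤ) → sum (λ v → a * f v + b) ≡ a * sum f + + n * b
  sum-affine {n} a b f =
    trans (∑-distrib-+ (λ v → a * f v) (λ _ → b)) (cong₂ _+_ (sum-scale a f) (sum-const n b))

  sum-remove₂ : ∀ {n} (x y : Fin (suc (suc n))) (x≢y : x ≢ y) (f : Fin (suc (suc n)) → ℤ) →
    sum f ≡ f x + (f y + sum (f ∘ punchIn x ∘ punchIn (punchOut x≢y)))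
  sum-remove₂ x y x≢y f = begin
    sum f                                       ≡⟨ sum-remove {i = x} f ⟩
    f x + sum (f ∘ punchIn x)                   ≡⟨ cong (_+_ (f x)) (sum-remove {i = y′} (f ∘ punchIn x)) ⟩
    f x + (f (punchIn x y′) + sum (f ∘ punchIn x ∘ punchIn y′))
                                                ≡⟨ cong (λ z → f x + (f z + sum (f ∘ punchIn x ∘ punchIn y′)))
                                                        (FinP.punchIn-punchOut x≢y) ⟩
    f x + (f y + sum (f ∘ punchIn x ∘ punchIn y′)) ∎
    where y′ = punchOut x≢y

  sum-update₂ : ∀ {n} (x y : Fin n) → x ≢ y → (H C : Fin n → ℤ) →
    (∀ v → v ≢ x → v ≢ y → H v ≡ C v) → sum H ≡ H x + H y + (sum C - C x - C y)
  sum-update₂ {suc (suc n)} x y x≢y H C agree = begin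
    sum H                    ≡⟨ sum-remove₂ x y x≢y H ⟩
    H x + (H y + sum rest)   ≡⟨ cong (λ s → H x + (H y + s)) (sum-cong-≗ away) ⟩
    H x + (H y + sum rest′)  ≡⟨ regroup (H x) (H y) (C x) (C y) (sum rest′) ⟩
    H x + H y + (C x + (C y + sum rest′) - C x - C y)
                             ≡⟨ cong (λ s → H x + H y + (s - C x - C y)) (sym (sum-remove₂ x y x≢y C)) ⟩
    H x + H y + (sum C - C x - C y) ∎
    where
    y′ = punchOut x≢y
    rest = H ∘ punchIn x ∘ punchIn y′
    rest′ = C ∘ punchIn x ∘ punchIn y′
    regroup : ∀ hx hy cx cy s → hx + (hy + s) ≡ hx + hy + (cx + (cy + s) - cx - cy)
    regroup = solve-∀
    away : ∀ u → rest u ≡ rest′ u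
    away u = agree _ (FinP.punchInᵢ≢i x _)
      (λ e → FinP.punchInᵢ≢i y′ u (FinP.punchIn-injective x _ _
               (trans e (sym (FinP.punchIn-punchOut x≢y)))))
  sum-update₂ {suc zero} zero zero x≢y H C agree = contradiction refl x≢y

  count-below : ∀ n t → t ℕ.≤ n → sum {n} (λ v → ⟦ toℕ v ℕ.<? t ⟧) ≡ + t
  count-below zero zero _ = refl
  count-below (suc n) zero _ = begin
    + 0 + sum {n} (λ v → ⟦ suc (toℕ v) ℕ.<? 0 ⟧) ≡⟨ cong (_+_ (+ 0)) (sum-cong-≗ {n} (λ v → ⟦⟧-no (suc (toℕ v) ℕ.<? 0) λ ())) ⟩
    + 0 + sum {n} (λ _ → + 0)                   ≡⟨ cong (_+_ (+ 0)) (sum-zero n) ⟩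
    + 0                                         ∎
  count-below (suc n) (suc t) (s≤s t≤n) = cong (_+_ (+ 1)) (begin
    sum {n} (λ v → ⟦ suc (toℕ v) ℕ.<? suc t ⟧) ≡⟨ sum-cong-≗ {n} (λ v → ⟦⟧-⇔ _ (toℕ v ℕ.<? t) ℕP.≤-pred s≤s) ⟩
    sum {n} (λ v → ⟦ toℕ v ℕ.<? t ⟧)           ≡⟨ count-below n t t≤n ⟩
    + t                                        ∎)

  sum-sub : ∀ {n} (f g : Fin n → ℤ) → sum {n} (λ v → f v - g v) ≡ sum f - sum g
  sum-sub {n} f g = begin
    sum {n} (λ v → f v - g v)           ≡⟨ ∑-distrib-+ f (λ v → - g v) ⟩
    sum f + sum {n} (λ v → - g v)       ≡⟨ cong (_+_ (sum f)) (sum-cong-≗ (λ v → sym (ℤP.-1*i≡-i (g v)))) ⟩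
    sum f + sum {n} (λ v → - + 1 * g v) ≡⟨ cong (_+_ (sum f)) (trans (sum-scale (- + 1) g) (ℤP.-1*i≡-i (sum g))) ⟩
    sum f - sum g                       ∎

  count-window : ∀ n c a b → a ℕ.≤ n → b ℕ.≤ n →
    sum {n} (λ v → c * (⟦ toℕ v ℕ.<? b ⟧ - ⟦ toℕ v ℕ.<? a ⟧)) ≡ c * (+ b - + a)
  count-window n c a b a≤n b≤n = begin
    sum {n} (λ v → c * (⟦ toℕ v ℕ.<? b ⟧ - ⟦ toℕ v ℕ.<? a ⟧))
      ≡⟨ sum-scale {n} c (λ v → ⟦ toℕ v ℕ.<? b ⟧ - ⟦ toℕ v ℕ.<? a ⟧) ⟩
    c * sum {n} (λ v → ⟦ toℕ v ℕ.<? b ⟧ - ⟦ toℕ v ℕ.<? a ⟧)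
      ≡⟨ cong (c *_) (sum-sub {n} (λ v → ⟦ toℕ v ℕ.<? b ⟧) (λ v → ⟦ toℕ v ℕ.<? a ⟧)) ⟩
    c * (sum {n} (λ v → ⟦ toℕ v ℕ.<? b ⟧) - sum {n} (λ v → ⟦ toℕ v ℕ.<? a ⟧))
      ≡⟨ cong₂ (λ p q → c * (p - q)) (count-below n b b≤n) (count-below n a a≤n) ⟩
    c * (+ b - + a) ∎

  sum-toℕ : ∀ n → + 2 * sum {n} (λ v → + toℕ v) ≡ + n * (+ n - + 1)
  sum-toℕ zero = refl
  sum-toℕ (suc n) = begin
    + 2 * (+ 0 + sum {n} (λ v → + 1 + + toℕ v))
      ≡⟨ cong (λ s → + 2 * (+ 0 + s)) (∑-distrib-+ {n} (λ _ → + 1) (λ v → + toℕ v)) ⟩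
    + 2 * (+ 0 + (sum {n} (λ _ → + 1) + S))
      ≡⟨ cong (λ s → + 2 * (+ 0 + (s + S))) (sum-const n (+ 1)) ⟩
    + 2 * (+ 0 + (+ n * + 1 + S))
      ≡⟨ expand (+ n) S ⟩
    + 2 * S + + 2 * + n
      ≡⟨ cong (_+ + 2 * + n) (sum-toℕ n) ⟩
    + n * (+ n - + 1) + + 2 * + n
      ≡⟨ step (+ n) ⟩
    + suc n * (+ suc n - + 1) ∎
    where S = sum {n} (λ v → + toℕ v)
          expand : ∀ m s → + 2 * (+ 0 + (m * + 1 + s)) ≡ + 2 * s + + 2 * m
          expand = solve-∀
          step : ∀ m → m * (m - + 1) + + 2 * m ≡ (+ 1 + m) * ((+ 1 + m) - + 1)
          step = solve-∀

  -- Sums over permutations, by the first letter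

  extend : ∀ {n} → Fin (suc n) → Word n → Word (suc n)
  extend v w = v ∷ Vec.map (punchIn v) w

  lookup-extend : ∀ {n} v (w : Word n) c → lookup (extend v w) (suc c) ≡ punchIn v (lookup w c)
  lookup-extend v w c = VecP.lookup-map c (punchIn v) w

  extend-isPerm : ∀ {n} v (w : Word n) → IsPerm w → IsPerm (extend v w)
  extend-isPerm v w w-perm zero zero _ = refl
  extend-isPerm v w w-perm zero (suc j) e =
    contradiction (sym (trans e (lookup-extend v w j))) (FinP.punchInᵢ≢i v _)
  extend-isPerm v w w-perm (suc i) zero e =
    contradiction (trans (sym (lookup-extend v w i)) e) (FinP.punchInᵢ≢i v _)
  extend-isPerm v w w-perm (suc i) (suc j) e = cong suc (w-perm i j (FinP.punchIn-injective v _ _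
    (trans (sym (lookup-extend v w i)) (trans e (lookup-extend v w j)))))

  -- Σ_{σ ∈ 𝒮ₙ} g(σ), computed through the bijection [n+1] × 𝒮ₙ ≅ 𝒮ₙ₊₁, (v, w) ↦ extend v w.
  -- That this is the sum over the list 'Sn' of Defs is shown in 'count≡ΣPerm' below.
  ΣPerm : ∀ n → (Word n → ℤ) → ℤ
  ΣPerm zero g = g []
  ΣPerm (suc n) g = sum (λ v → ΣPerm n (g ∘ extend v))

  ΣPerm-cong : ∀ n {f g : Word n → ℤ} → (∀ σ → IsPerm σ → f σ ≡ g σ) → ΣPerm n f ≡ ΣPerm n g
  ΣPerm-cong zero agree = agree [] (λ ())
  ΣPerm-cong (suc n) agree =
    sum-cong-≗ (λ v → ΣPerm-cong n (λ w w-perm → agree (extend v w) (extend-isPerm v w w-perm)))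

  ΣPerm-+ : ∀ n (f g : Word n → ℤ) → ΣPerm n (λ σ → f σ + g σ) ≡ ΣPerm n f + ΣPerm n g
  ΣPerm-+ zero f g = refl
  ΣPerm-+ (suc n) f g = trans (sum-cong-≗ (λ v → ΣPerm-+ n (f ∘ extend v) (g ∘ extend v)))
                             (∑-distrib-+ (λ v → ΣPerm n (f ∘ extend v)) (λ v → ΣPerm n (g ∘ extend v)))

  ΣPerm-scale : ∀ n c (f : Word n → ℤ) → ΣPerm n (λ σ → c * f σ) ≡ c * ΣPerm n f
  ΣPerm-scale zero c f = refl
  ΣPerm-scale (suc n) c f = trans (sum-cong-≗ (λ v → ΣPerm-scale n c (f ∘ extend v)))
                                  (sum-scale c (λ v → ΣPerm n (f ∘ extend v)))

  ΣPerm-neg : ∀ n (f : Word n → ℤ) → ΣPerm n (λ σ → - f σ) ≡ - ΣPerm n f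
  ΣPerm-neg n f = begin
    ΣPerm n (λ σ → - f σ)        ≡⟨ ΣPerm-cong n (λ σ _ → sym (ℤP.-1*i≡-i (f σ))) ⟩
    ΣPerm n (λ σ → - + 1 * f σ)  ≡⟨ ΣPerm-scale n (- + 1) f ⟩
    - + 1 * ΣPerm n f            ≡⟨ ℤP.-1*i≡-i (ΣPerm n f) ⟩
    - ΣPerm n f                  ∎

  fac : ℕ → ℤ
  fac k = + (k !)

  fac-suc : ∀ k → fac (suc k) ≡ + suc k * fac k
  fac-suc k = ℤP.pos-* (suc k) (k !)

  ΣPerm-const : ∀ n c → ΣPerm n (λ _ → c) ≡ c * fac n
  ΣPerm-const zero c = sym (ℤP.*-identityʳ c)
  ΣPerm-const (suc n) c = begin
    sum {suc n} (λ _ → ΣPerm n (λ _ → c))  ≡⟨ sum-cong-≗ {suc n} (λ _ → ΣPerm-const n c) ⟩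
    sum {suc n} (λ _ → c * fac n)          ≡⟨ sum-const (suc n) (c * fac n) ⟩
    + suc n * (c * fac n)                  ≡⟨ reorder (+ suc n) c (fac n) ⟩
    c * (+ suc n * fac n)                  ≡⟨ cong (c *_) (sym (fac-suc n)) ⟩
    c * fac (suc n)                        ∎
    where reorder : ∀ m c f → m * (c * f) ≡ c * (m * f)
          reorder = solve-∀

  ΣPerm-affine : ∀ n a b (f : Word n → ℤ) → ΣPerm n (λ σ → a * f σ + b) ≡ a * ΣPerm n f + b * fac n
  ΣPerm-affine n a b f =
    trans (ΣPerm-+ n (λ σ → a * f σ) (λ _ → b)) (cong₂ _+_ (ΣPerm-scale n a f) (ΣPerm-const n b))

  inv-at : ∀ {n} (σ : Word n) → IsPerm σ → ∀ k p → lookup σ k ≡ p → inv σ p ≡ k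
  inv-at σ σ-perm k p σk≡p with FinP.any? (λ k → lookup σ k FinP.≟ p)
  ... | yes (k′ , σk′≡p) = σ-perm k′ k (trans σk′≡p (sym σk≡p))
  ... | no ∄k = contradiction (k , σk≡p) ∄k

  -- An injective self-map of [n] is onto (pigeonhole).
  isPerm-onto : ∀ {n} (σ : Word n) → IsPerm σ → ∀ p → ∃ λ k → lookup σ k ≡ p
  isPerm-onto {suc n} σ σ-perm p with FinP.any? (λ k → lookup σ k FinP.≟ p)
  ... | yes found = found
  ... | no ∄k = contradiction (FinP.injective⇒≤ {f = squeeze} squeeze-injective) (ℕP.<-irrefl refl)
    where
    squeeze : Fin (suc n) → Fin n
    squeeze i = punchOut {i = p} {j = lookup σ i} (λ e → ∄k (i , sym e))
    squeeze-injective : ∀ {i j} → squeeze i ≡ squeeze j → i ≡ j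
    squeeze-injective {i} {j} e =
      σ-perm i j (FinP.punchOut-injective (λ e₁ → ∄k (i , sym e₁)) (λ e₁ → ∄k (j , sym e₁)) e)

  lookup-inv : ∀ {n} (σ : Word n) → IsPerm σ → ∀ p → lookup σ (inv σ p) ≡ p
  lookup-inv σ σ-perm p with isPerm-onto σ σ-perm p
  ... | k , σk≡p rewrite inv-at σ σ-perm k p σk≡p = σk≡p

  inv-extend-first : ∀ {n} v (w : Word n) → IsPerm w → inv (extend v w) v ≡ zero
  inv-extend-first v w w-perm = inv-at (extend v w) (extend-isPerm v w w-perm) zero v refl

  inv-extend-rest : ∀ {n} v (w : Word n) → IsPerm w → ∀ z → inv (extend v w) (punchIn v z) ≡ suc (inv w z)
  inv-extend-rest v w w-perm z = inv-at (extend v w) (extend-isPerm v w w-perm) (suc (inv w z)) (punchIn v z)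
    (trans (lookup-extend v w (inv w z)) (cong (punchIn v) (lookup-inv w w-perm z)))

  punchOutℕ : ℕ → ℕ → ℕ
  punchOutℕ zero zero = zero
  punchOutℕ zero (suc t) = t
  punchOutℕ (suc v) zero = zero
  punchOutℕ (suc v) (suc t) = suc (punchOutℕ v t)

  punchOutℕ-punchIn : ∀ {n} (v : Fin (suc n)) z → punchOutℕ (toℕ v) (toℕ (punchIn v z)) ≡ toℕ z
  punchOutℕ-punchIn zero z = refl
  punchOutℕ-punchIn (suc v) zero = refl
  punchOutℕ-punchIn (suc v) (suc z) = cong suc (punchOutℕ-punchIn v z)

  toℕ-punchOut : ∀ {n} {v x : Fin (suc n)} (v≢x : v ≢ x) → toℕ (punchOut v≢x) ≡ punchOutℕ (toℕ v) (toℕ x)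
  toℕ-punchOut {v = v} v≢x = trans (sym (punchOutℕ-punchIn v (punchOut v≢x)))
                                   (cong (λ q → punchOutℕ (toℕ v) (toℕ q)) (FinP.punchIn-punchOut v≢x))

  punchOutℕ-self : ∀ v → punchOutℕ v v ≡ v
  punchOutℕ-self zero = refl
  punchOutℕ-self (suc v) = cong suc (punchOutℕ-self v)

  punchOutℕ-ℤ : ∀ v t → + punchOutℕ v t ≡ + t - ⟦ v ℕ.<? t ⟧
  punchOutℕ-ℤ zero zero = refl
  punchOutℕ-ℤ zero (suc t) = sym (ℤP.m-n≡m⊖n (suc t) 1)
  punchOutℕ-ℤ (suc v) zero = refl
  punchOutℕ-ℤ (suc v) (suc t) = begin
    + 1 + + punchOutℕ v t           ≡⟨ cong (_+_ (+ 1)) (punchOutℕ-ℤ v t) ⟩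
    + 1 + (+ t - ⟦ v ℕ.<? t ⟧)      ≡⟨ regroup (+ t) ⟦ v ℕ.<? t ⟧ ⟩
    + 1 + + t - ⟦ v ℕ.<? t ⟧        ≡⟨ cong (λ i → + 1 + + t - i) (⟦⟧-⇔ (v ℕ.<? t) (suc v ℕ.<? suc t) s≤s ℕP.≤-pred) ⟩
    + 1 + + t - ⟦ suc v ℕ.<? suc t ⟧ ∎
    where regroup : ∀ a b → + 1 + (a - b) ≡ + 1 + a - b
          regroup = solve-∀

  punchOutℕ-mono-< : ∀ v a b → a ≢ v → a ℕ.< b → punchOutℕ v a ℕ.< punchOutℕ v b
  punchOutℕ-mono-< zero zero b a≢v _ = contradiction refl a≢v
  punchOutℕ-mono-< zero (suc a) (suc b) a≢v (s≤s a<b) = a<b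
  punchOutℕ-mono-< (suc v) zero (suc b) a≢v _ = s≤s z≤n
  punchOutℕ-mono-< (suc v) (suc a) (suc b) a≢v (s≤s a<b) = s≤s (punchOutℕ-mono-< v a b (a≢v ∘ cong suc) a<b)

  punchOutℕ-cancel-< : ∀ v a b → a ≢ v → punchOutℕ v a ℕ.< punchOutℕ v b → a ℕ.< b
  punchOutℕ-cancel-< zero zero b a≢v _ = contradiction refl a≢v
  punchOutℕ-cancel-< zero (suc a) (suc b) a≢v a<b = s≤s a<b
  punchOutℕ-cancel-< (suc v) zero (suc b) a≢v _ = s≤s z≤n
  punchOutℕ-cancel-< (suc v) (suc a) (suc b) a≢v (s≤s a<b) = s≤s (punchOutℕ-cancel-< v a b (a≢v ∘ cong suc) a<b)
  punchOutℕ-cancel-< zero (suc a) zero a≢v ()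
  punchOutℕ-cancel-< (suc v) zero zero a≢v ()
  punchOutℕ-cancel-< (suc v) (suc a) zero a≢v ()

  punchOutℕ-≤ : ∀ v t k → v ℕ.≤ k → t ℕ.≤ suc k → punchOutℕ v t ℕ.≤ k
  punchOutℕ-≤ zero zero k _ _ = z≤n
  punchOutℕ-≤ zero (suc t) k _ (s≤s t≤k) = t≤k
  punchOutℕ-≤ (suc v) zero k _ _ = z≤n
  punchOutℕ-≤ (suc v) (suc t) (suc k) (s≤s v≤k) (s≤s t≤k) = s≤s (punchOutℕ-≤ v t k v≤k t≤k)

  punchOutℕ-bounded : ∀ {k} (v : Fin (suc k)) t → t ℕ.≤ suc k → punchOutℕ (toℕ v) t ℕ.≤ k
  punchOutℕ-bounded v t t≤ = punchOutℕ-≤ (toℕ v) t _ (ℕP.≤-pred (FinP.toℕ<n v)) t≤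

  -- punchIn v moves z past v exactly when z ≥ v, so it does not change whether z lies below v.
  punchIn-below : ∀ {n} (v : Fin (suc n)) z → toℕ z ℕ.< toℕ v → toℕ (punchIn v z) ℕ.< toℕ v
  punchIn-below (suc v) zero _ = s≤s z≤n
  punchIn-below (suc v) (suc z) (s≤s z<v) = s≤s (punchIn-below v z z<v)

  punchIn-below⁻¹ : ∀ {n} (v : Fin (suc n)) z → toℕ (punchIn v z) ℕ.< toℕ v → toℕ z ℕ.< toℕ v
  punchIn-below⁻¹ (suc v) zero _ = s≤s z≤n
  punchIn-below⁻¹ (suc v) (suc z) (s≤s z<v) = s≤s (punchIn-below⁻¹ v z z<v)

  punchOut-mono-< : ∀ {n} {v x y : Fin (suc n)} (v≢x : v ≢ x) (v≢y : v ≢ y) →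
    x Fin.< y → punchOut v≢x Fin.< punchOut v≢y
  punchOut-mono-< v≢x v≢y x<y = FinP.≤∧≢⇒< (FinP.punchOut-mono-≤ v≢x v≢y (ℕP.<⇒≤ x<y))
    (λ e → FinP.<⇒≢ x<y (FinP.punchOut-injective v≢x v≢y e))

  -- The statistics and how they transform under 'extend'

  desc : ∀ {n} → Fin n → Fin n → Word n → ℤ
  desc a b σ = ⟦ lookup σ b Fin.<? lookup σ a ⟧

  invDesc : ∀ {n} → Fin n → Fin n → Word n → ℤ
  invDesc x y σ = ⟦ inv σ y Fin.<? inv σ x ⟧

  sgn : ∀ {n} → Fin n → Fin n → Word n → ℤ
  sgn a b σ = desc a b σ - desc b a σ

  invSgn : ∀ {n} → Fin n → Fin n → Word n → ℤ
  invSgn x y σ = invDesc x y σ - invDesc y x σ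

  below : ∀ {n} → Fin n → ℕ → Word n → ℤ
  below c t σ = ⟦ toℕ (lookup σ c) ℕ.<? t ⟧

  desc-compl : ∀ {n} (σ : Word n) → IsPerm σ → ∀ a b → a ≢ b → desc a b σ + desc b a σ ≡ + 1
  desc-compl σ σ-perm a b a≢b = ⟦<⟧-total (lookup σ a) (lookup σ b) (a≢b ∘ σ-perm a b)

  invDesc-compl : ∀ {n} (σ : Word n) → IsPerm σ → ∀ x y → x ≢ y → invDesc x y σ + invDesc y x σ ≡ + 1
  invDesc-compl σ σ-perm x y x≢y = ⟦<⟧-total (inv σ x) (inv σ y)
    (λ e → x≢y (trans (sym (lookup-inv σ σ-perm x)) (trans (cong (lookup σ) e) (lookup-inv σ σ-perm y))))

  invSgn-extend : ∀ {n} v (w : Word n) → IsPerm w → ∀ x y →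
    invSgn (punchIn v x) (punchIn v y) (extend v w) ≡ invSgn x y w
  invSgn-extend v w w-perm x y = cong₂ _-_ (shifted x y) (shifted y x)
    where
    shifted : ∀ x y → invDesc (punchIn v x) (punchIn v y) (extend v w) ≡ invDesc x y w
    shifted x y rewrite inv-extend-rest v w w-perm x | inv-extend-rest v w w-perm y =
      ⟦⟧-⇔ (suc (inv w y) Fin.<? suc (inv w x)) (inv w y Fin.<? inv w x) ℕP.≤-pred s≤s

  invSgn-extend-first : ∀ {n} v (w : Word n) → IsPerm w → ∀ x → invSgn (punchIn v x) v (extend v w) ≡ + 1
  invSgn-extend-first {n} v w w-perm x rewrite inv-extend-rest v w w-perm x | inv-extend-first v w w-perm =
    cong₂ _-_ (⟦⟧-yes (zero {n} Fin.<? suc (inv w x)) (s≤s z≤n)) (⟦⟧-no (suc (inv w x) Fin.<? zero {n}) λ ())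

  invSgn-at-second : ∀ {n} (x y : Fin (suc n)) → x ≢ y → (w : Word n) → IsPerm w → invSgn x y (extend y w) ≡ + 1
  invSgn-at-second x y x≢y w w-perm = subst (λ x₀ → invSgn x₀ y (extend y w) ≡ + 1)
    (FinP.punchIn-punchOut (x≢y ∘ sym)) (invSgn-extend-first y w w-perm (punchOut (x≢y ∘ sym)))

  invSgn-at-first : ∀ {n} (x y : Fin (suc n)) → x ≢ y → (w : Word n) → IsPerm w → invSgn x y (extend x w) ≡ - + 1
  invSgn-at-first x y x≢y w w-perm = begin
    invSgn x y (extend x w)   ≡⟨ antisymmetric (invDesc x y (extend x w)) (invDesc y x (extend x w)) ⟩
    - invSgn y x (extend x w) ≡⟨ cong -_ (invSgn-at-second y x (x≢y ∘ sym) w w-perm) ⟩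
    - + 1                     ∎
    where antisymmetric : ∀ a b → a - b ≡ - (b - a)
          antisymmetric = solve-∀

  invSgn-at-other : ∀ {n} (x y v : Fin (suc n)) (v≢x : v ≢ x) (v≢y : v ≢ y) → (w : Word n) → IsPerm w →
    invSgn x y (extend v w) ≡ invSgn (punchOut v≢x) (punchOut v≢y) w
  invSgn-at-other x y v v≢x v≢y w w-perm =
    subst₂ (λ x₀ y₀ → invSgn x₀ y₀ (extend v w) ≡ invSgn (punchOut v≢x) (punchOut v≢y) w)
      (FinP.punchIn-punchOut v≢x) (FinP.punchIn-punchOut v≢y) (invSgn-extend v w w-perm (punchOut v≢x) (punchOut v≢y))

  below-extend : ∀ {n} v (w : Word n) c t → below (suc c) t (extend v w) ≡ below c (punchOutℕ (toℕ v) t) w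
  below-extend v w c t rewrite lookup-extend v w c = ⟦⟧-⇔ _ _
    (λ h → subst (ℕ._< punchOutℕ (toℕ v) t) (punchOutℕ-punchIn v z)
                 (punchOutℕ-mono-< (toℕ v) (toℕ (punchIn v z)) t (punchIn≢ v z) h))
    (λ h → punchOutℕ-cancel-< (toℕ v) (toℕ (punchIn v z)) t (punchIn≢ v z)
                 (subst (ℕ._< punchOutℕ (toℕ v) t) (sym (punchOutℕ-punchIn v z)) h))
    where
    z = lookup w c
    punchIn≢ : ∀ {n} (v : Fin (suc n)) z → toℕ (punchIn v z) ≢ toℕ v
    punchIn≢ v z e = FinP.punchInᵢ≢i v z (FinP.toℕ-injective e)

  sgn-extend : ∀ {n} v (w : Word n) a b → sgn (suc a) (suc b) (extend v w) ≡ sgn a b w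
  sgn-extend v w a b rewrite lookup-extend v w a | lookup-extend v w b = cong₂ _-_ (renumbered a b) (renumbered b a)
    where
    renumbered : ∀ a b → ⟦ punchIn v (lookup w b) Fin.<? punchIn v (lookup w a) ⟧ ≡ desc a b w
    renumbered a b = ⟦⟧-⇔ _ _
      (λ h → ℕP.≰⇒> (λ le → ℕP.<⇒≱ h (FinP.punchIn-mono-≤ v _ _ le)))
      (λ h → ℕP.≰⇒> (λ le → ℕP.<⇒≱ h (FinP.punchIn-cancel-≤ v _ _ le)))

  sgn-extend-first : ∀ {n} v (w : Word n) b → sgn zero (suc b) (extend v w) ≡ + 2 * below b (toℕ v) w - + 1
  sgn-extend-first v w b rewrite lookup-extend v w b = begin
    ⟦ punchIn v z Fin.<? v ⟧ - ⟦ v Fin.<? punchIn v z ⟧ ≡⟨ cong₂ _-_ lower upper ⟩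
    L - (+ 1 - L)                                      ≡⟨ double L ⟩
    + 2 * L - + 1                                      ∎
    where
    z = lookup w b
    L = ⟦ toℕ z ℕ.<? toℕ v ⟧
    lower : ⟦ punchIn v z Fin.<? v ⟧ ≡ L
    lower = ⟦⟧-⇔ _ _ (punchIn-below⁻¹ v z) (punchIn-below v z)
    upper : ⟦ v Fin.<? punchIn v z ⟧ ≡ + 1 - L
    upper with toℕ z ℕ.<? toℕ v
    ... | yes z<v = ⟦⟧-no _ (λ h → ℕP.<-asym h (punchIn-below v z z<v))
    ... | no z≮v = ⟦⟧-yes _ (FinP.≤∧≢⇒< (ℕP.≮⇒≥ (z≮v ∘ punchIn-below⁻¹ v z)) (FinP.punchInᵢ≢i v z ∘ sym))
    double : ∀ l → l - (+ 1 - l) ≡ + 2 * l - + 1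
    double = solve-∀

  -- Expanding Σ_σ g(σ)·invSgn x y (σ) by the first letter v of σ: it is +1 when v = y,
  -- −1 when v = x, and otherwise the sign of the renumbered pair in the rest of σ.
  ΣPerm-invSgn-expand : ∀ n (x y : Fin (suc n)) → x ≢ y → (g : Word (suc n) → ℤ) (C : Fin (suc n) → ℤ) →
    (∀ v (v≢x : v ≢ x) (v≢y : v ≢ y) →
       ΣPerm n (λ w → g (extend v w) * invSgn (punchOut v≢x) (punchOut v≢y) w) ≡ C v) →
    ΣPerm (suc n) (λ σ → g σ * invSgn x y σ)
      ≡ - ΣPerm n (g ∘ extend x) + ΣPerm n (g ∘ extend y) + (sum C - C x - C y)
  ΣPerm-invSgn-expand n x y x≢y g C other = begin
    sum H                           ≡⟨ sum-update₂ x y x≢y H C away ⟩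
    H x + H y + (sum C - C x - C y) ≡⟨ cong₂ (λ p q → p + q + (sum C - C x - C y)) first-x first-y ⟩
    - ΣPerm n (g ∘ extend x) + ΣPerm n (g ∘ extend y) + (sum C - C x - C y) ∎
    where
    H : Fin (suc n) → ℤ
    H v = ΣPerm n (λ w → g (extend v w) * invSgn x y (extend v w))
    first-y : H y ≡ ΣPerm n (g ∘ extend y)
    first-y = ΣPerm-cong n (λ w w-perm →
      trans (cong (g (extend y w) *_) (invSgn-at-second x y x≢y w w-perm)) (ℤP.*-identityʳ _))
    first-x : H x ≡ - ΣPerm n (g ∘ extend x)
    first-x = trans (ΣPerm-cong n (λ w w-perm →
        trans (cong (g (extend x w) *_) (invSgn-at-first x y x≢y w w-perm))
              (trans (ℤP.*-comm (g (extend x w)) (- + 1)) (ℤP.-1*i≡-i _))))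
      (ΣPerm-neg n (g ∘ extend x))
    away : ∀ v → v ≢ x → v ≢ y → H v ≡ C v
    away v v≢x v≢y = trans (ΣPerm-cong n (λ w w-perm →
      cong (g (extend v w) *_) (invSgn-at-other x y v v≢x v≢y w w-perm))) (other v v≢x v≢y)

  ΣPerm-invSgn : ∀ n (x y : Fin n) → x ≢ y → ΣPerm n (invSgn x y) ≡ + 0
  ΣPerm-invSgn (suc n) x y x≢y = begin
    ΣPerm (suc n) (invSgn x y)                ≡⟨ ΣPerm-cong (suc n) (λ σ _ → sym (ℤP.*-identityˡ (invSgn x y σ))) ⟩
    ΣPerm (suc n) (λ σ → + 1 * invSgn x y σ)  ≡⟨ ΣPerm-invSgn-expand n x y x≢y (λ _ → + 1) (λ _ → + 0) rest ⟩
    - N + N + (sum {suc n} (λ _ → + 0) - + 0 - + 0) ≡⟨ cong (λ s → - N + N + (s - + 0 - + 0)) (sum-zero (suc n)) ⟩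
    - N + N + (+ 0 - + 0 - + 0)               ≡⟨ cancel N ⟩
    + 0                                       ∎
    where
    N = ΣPerm n (λ _ → + 1)
    rest : ∀ v (v≢x : v ≢ x) (v≢y : v ≢ y) → ΣPerm n (λ w → + 1 * invSgn (punchOut v≢x) (punchOut v≢y) w) ≡ + 0
    rest v v≢x v≢y = trans (ΣPerm-cong n (λ w _ → ℤP.*-identityˡ _))
      (ΣPerm-invSgn n _ _ (x≢y ∘ FinP.punchOut-injective v≢x v≢y))
    cancel : ∀ a → - a + a + (+ 0 - + 0 - + 0) ≡ + 0
    cancel = solve-∀

  -- Every value occurs equally often at position c: Σ_σ [σ(c) < t] = t·(n−1)!.
  ΣPerm-below : ∀ m (c : Fin (suc m)) t → t ℕ.≤ suc m → ΣPerm (suc m) (below c t) ≡ + t * fac m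
  ΣPerm-below m zero t t≤ = begin
    sum {suc m} (λ v → ΣPerm m (λ _ → L v))
      ≡⟨ sum-cong-≗ {suc m} (λ v → trans (ΣPerm-const m (L v)) (ℤP.*-comm (L v) (fac m))) ⟩
    sum {suc m} (λ v → fac m * L v)
      ≡⟨ sum-scale {suc m} (fac m) L ⟩
    fac m * sum {suc m} L
      ≡⟨ cong (fac m *_) (count-below (suc m) t t≤) ⟩
    fac m * + t
      ≡⟨ ℤP.*-comm (fac m) (+ t) ⟩
    + t * fac m ∎
    where L : Fin (suc m) → ℤ
          L v = ⟦ toℕ v ℕ.<? t ⟧
  ΣPerm-below (suc m) (suc c) t t≤ = begin
    sum {suc (suc m)} (λ v → ΣPerm (suc m) (below (suc c) t ∘ extend v))
      ≡⟨ sum-cong-≗ {suc (suc m)} (λ v → trans (ΣPerm-cong (suc m) (λ w _ → below-extend v w c t))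
                                 (ΣPerm-below m c (punchOutℕ (toℕ v) t) (punchOutℕ-bounded v t t≤))) ⟩
    sum {suc (suc m)} (λ v → + punchOutℕ (toℕ v) t * fac m)
      ≡⟨ sum-cong-≗ {suc (suc m)} (λ v → trans (cong (_* fac m) (punchOutℕ-ℤ (toℕ v) t)) (expand (+ t) ⟦ toℕ v ℕ.<? t ⟧ (fac m))) ⟩
    sum {suc (suc m)} (λ v → - fac m * ⟦ toℕ v ℕ.<? t ⟧ + + t * fac m)
      ≡⟨ sum-affine {suc (suc m)} (- fac m) (+ t * fac m) (λ v → ⟦ toℕ v ℕ.<? t ⟧) ⟩
    - fac m * sum {suc (suc m)} (λ v → ⟦ toℕ v ℕ.<? t ⟧) + + suc (suc m) * (+ t * fac m)
      ≡⟨ cong (λ s → - fac m * s + + suc (suc m) * (+ t * fac m)) (count-below (suc (suc m)) t t≤) ⟩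
    - fac m * + t + + suc (suc m) * (+ t * fac m)
      ≡⟨ collect (+ t) (fac m) (+ m) ⟩
    + t * (+ suc m * fac m)
      ≡⟨ cong (+ t *_) (sym (fac-suc m)) ⟩
    + t * fac (suc m) ∎
    where
    expand : ∀ t i f → (t - i) * f ≡ - f * i + t * f
    expand = solve-∀
    collect : ∀ t f m → - f * t + (+ 2 + m) * (t * f) ≡ t * ((+ 1 + m) * f)
    collect = solve-∀

  ΣPerm-sgn-first : ∀ m (v : Fin (suc (suc m))) b →
    ΣPerm (suc m) (λ w → sgn zero (suc b) (extend v w)) ≡ + 2 * (+ toℕ v * fac m) - fac (suc m)
  ΣPerm-sgn-first m v b = begin
    ΣPerm (suc m) (λ w → sgn zero (suc b) (extend v w))
      ≡⟨ ΣPerm-cong (suc m) (λ w _ → sgn-extend-first v w b) ⟩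
    ΣPerm (suc m) (λ w → + 2 * below b (toℕ v) w + - + 1)
      ≡⟨ ΣPerm-affine (suc m) (+ 2) (- + 1) (below b (toℕ v)) ⟩
    + 2 * ΣPerm (suc m) (below b (toℕ v)) + - + 1 * fac (suc m)
      ≡⟨ cong (λ s → + 2 * s + - + 1 * fac (suc m)) (ΣPerm-below m b (toℕ v) (ℕP.≤-pred (FinP.toℕ<n v))) ⟩
    + 2 * (+ toℕ v * fac m) + - + 1 * fac (suc m)
      ≡⟨ cong (_+_ (+ 2 * (+ toℕ v * fac m))) (ℤP.-1*i≡-i (fac (suc m))) ⟩
    + 2 * (+ toℕ v * fac m) - fac (suc m) ∎

  ΣPerm-sgn : ∀ n (a b : Fin n) → a Fin.< b → ΣPerm n (sgn a b) ≡ + 0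
  ΣPerm-sgn (suc (suc m)) zero (suc b) _ = begin
    sum {suc (suc m)} (λ v → ΣPerm (suc m) (λ w → sgn zero (suc b) (extend v w)))
      ≡⟨ sum-cong-≗ {suc (suc m)} (λ v → trans (ΣPerm-sgn-first m v b) (reorder (+ toℕ v) (fac m) (fac (suc m)))) ⟩
    sum {suc (suc m)} (λ v → fac m * (+ 2 * + toℕ v) + - fac (suc m))
      ≡⟨ sum-affine {suc (suc m)} (fac m) (- fac (suc m)) (λ v → + 2 * + toℕ v) ⟩
    fac m * sum {suc (suc m)} (λ v → + 2 * + toℕ v) + + suc (suc m) * - fac (suc m)
      ≡⟨ cong₂ (λ s f → fac m * s + + suc (suc m) * - f)
               (trans (sum-scale {suc (suc m)} (+ 2) (λ v → + toℕ v)) (sum-toℕ (suc (suc m)))) (fac-suc m) ⟩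
    fac m * (+ suc (suc m) * (+ suc (suc m) - + 1)) + + suc (suc m) * - (+ suc m * fac m)
      ≡⟨ vanish (+ m) (fac m) ⟩
    + 0 ∎
    where
    reorder : ∀ v f g → + 2 * (v * f) - g ≡ f * (+ 2 * v) + - g
    reorder = solve-∀
    vanish : ∀ m f → f * ((+ 2 + m) * ((+ 2 + m) - + 1)) + (+ 2 + m) * - ((+ 1 + m) * f) ≡ + 0
    vanish = solve-∀
  ΣPerm-sgn (suc n) (suc a) (suc b) (s≤s a<b) = begin
    sum {suc n} (λ v → ΣPerm n (sgn (suc a) (suc b) ∘ extend v))
      ≡⟨ sum-cong-≗ {suc n} (λ v → trans (ΣPerm-cong n (λ w _ → sgn-extend v w a b)) (ΣPerm-sgn n a b a<b)) ⟩
    sum {suc n} (λ _ → + 0)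
      ≡⟨ sum-zero (suc n) ⟩
    + 0 ∎

  ⟦⟧-difference : {P Q R : Set} (p : Dec P) (q : Dec Q) (r : Dec R) →
    (Q → P) → (R → ¬ Q) → (¬ Q → R) → ⟦ p ⟧ * ⟦ r ⟧ ≡ ⟦ p ⟧ - ⟦ q ⟧
  ⟦⟧-difference (yes _) (yes q) (yes r) _ r⇒¬q _ = contradiction q (r⇒¬q r)
  ⟦⟧-difference (yes _) (yes _) (no _) _ _ _ = refl
  ⟦⟧-difference (yes _) (no _) (yes _) _ _ _ = refl
  ⟦⟧-difference (yes _) (no ¬q) (no ¬r) _ _ ¬q⇒r = contradiction (¬q⇒r ¬q) ¬r
  ⟦⟧-difference (no ¬p) (yes q) _ q⇒p _ _ = contradiction (q⇒p q) ¬p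
  ⟦⟧-difference (no _) (no _) (yes _) _ _ _ = refl
  ⟦⟧-difference (no _) (no _) (no _) _ _ _ = refl

  between : ℕ → ℕ → ℕ → ℤ
  between x t y = ⟦ x ℕ.<? t ⟧ * ⟦ t ℕ.≤? y ⟧

  between-thresholds : ∀ x t y → x ℕ.< y → between x t y ≡ ⟦ x ℕ.<? t ⟧ - ⟦ y ℕ.<? t ⟧
  between-thresholds x t y x<y =
    ⟦⟧-difference (x ℕ.<? t) (y ℕ.<? t) (t ℕ.≤? y) (ℕP.<-trans x<y) ℕP.≤⇒≯ ℕP.≮⇒≥

  between-points : ∀ x t y → x ℕ.< y → between x t y ≡ ⟦ t ℕ.<? suc y ⟧ - ⟦ t ℕ.<? suc x ⟧
  between-points x t y x<y = begin
    ⟦ x ℕ.<? t ⟧ * ⟦ t ℕ.≤? y ⟧ ≡⟨ ℤP.*-comm ⟦ x ℕ.<? t ⟧ ⟦ t ℕ.≤? y ⟧ ⟩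
    ⟦ t ℕ.≤? y ⟧ * ⟦ x ℕ.<? t ⟧ ≡⟨ ⟦⟧-difference (t ℕ.≤? y) (t ℕ.≤? x) (x ℕ.<? t)
                                     (λ t≤x → ℕP.≤-trans t≤x (ℕP.<⇒≤ x<y)) ℕP.<⇒≱ ℕP.≰⇒> ⟩
    ⟦ t ℕ.≤? y ⟧ - ⟦ t ℕ.≤? x ⟧ ≡⟨ cong₂ _-_ (⟦⟧-⇔ (t ℕ.≤? y) (t ℕ.<? suc y) s≤s ℕP.≤-pred)
                                             (⟦⟧-⇔ (t ℕ.≤? x) (t ℕ.<? suc x) s≤s ℕP.≤-pred) ⟩
    ⟦ t ℕ.<? suc y ⟧ - ⟦ t ℕ.<? suc x ⟧ ∎

  between-punchOutℕ : ∀ v x t y → x ≢ v → y ≢ v →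
    between (punchOutℕ v x) (punchOutℕ v t) (punchOutℕ v y) ≡ between x t y
  between-punchOutℕ v x t y x≢v y≢v = cong₂ _*_
    (⟦⟧-⇔ (punchOutℕ v x ℕ.<? punchOutℕ v t) (x ℕ.<? t) (punchOutℕ-cancel-< v x t x≢v) (punchOutℕ-mono-< v x t x≢v))
    (⟦⟧-⇔ (punchOutℕ v t ℕ.≤? punchOutℕ v y) (t ℕ.≤? y) (λ h → ℕP.≮⇒≥ (λ h′ → ℕP.<⇒≱ (punchOutℕ-mono-< v y t y≢v h′) h))
              (λ h → ℕP.≮⇒≥ (λ h′ → ℕP.<⇒≱ (punchOutℕ-cancel-< v y t y≢v h′) h)))

  toℕ-≢ : ∀ {n} {a b : Fin n} → a ≢ b → toℕ a ≢ toℕ b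
  toℕ-≢ a≢b e = a≢b (FinP.toℕ-injective e)

  -- The auxiliary correlation  Σ_σ [σ(c) < t]·invSgn x y (σ)

  -- 2c + 1 − n: the number of positions before c minus the number after it.
  offset : ∀ {n} → Fin n → ℕ → ℤ
  offset c n = + 2 * + toℕ c + + 1 - + n

  -- Position 0: [σ(0) < t] only depends on the first letter, and the rest averages invSgn to 0.
  ΣPerm-below₀-invSgn : ∀ k t (x y : Fin (suc (suc k))) → x Fin.< y →
    ΣPerm (suc (suc k)) (λ σ → below zero t σ * invSgn x y σ)
      ≡ between (toℕ x) t (toℕ y) * offset (zero {suc k}) (suc (suc k)) * fac k
  ΣPerm-below₀-invSgn k t x y x<y = begin
    ΣPerm (suc (suc k)) (λ σ → below zero t σ * invSgn x y σ)
      ≡⟨ ΣPerm-invSgn-expand (suc k) x y (FinP.<⇒≢ x<y) (below zero t) (λ _ → + 0) rest ⟩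
    - ΣPerm (suc k) (λ _ → Lx) + ΣPerm (suc k) (λ _ → Ly) + (sum {suc (suc k)} (λ _ → + 0) - + 0 - + 0)
      ≡⟨ cong₂ (λ p s → - p + ΣPerm (suc k) (λ _ → Ly) + (s - + 0 - + 0)) (ΣPerm-const (suc k) Lx) (sum-zero (suc (suc k))) ⟩
    - (Lx * fac (suc k)) + ΣPerm (suc k) (λ _ → Ly) + (+ 0 - + 0 - + 0)
      ≡⟨ cong (λ p → - (Lx * fac (suc k)) + p + (+ 0 - + 0 - + 0)) (ΣPerm-const (suc k) Ly) ⟩
    - (Lx * fac (suc k)) + Ly * fac (suc k) + (+ 0 - + 0 - + 0)
      ≡⟨ cong (λ f → - (Lx * f) + Ly * f + (+ 0 - + 0 - + 0)) (fac-suc k) ⟩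
    - (Lx * ((+ 1 + + k) * fac k)) + Ly * ((+ 1 + + k) * fac k) + (+ 0 - + 0 - + 0)
      ≡⟨ collect Lx Ly (+ k) (fac k) ⟩
    (Lx - Ly) * (+ 2 * + 0 + + 1 - (+ 2 + + k)) * fac k
      ≡⟨ cong (λ i → i * offset (zero {suc k}) (suc (suc k)) * fac k) (sym (between-thresholds (toℕ x) t (toℕ y) x<y)) ⟩
    between (toℕ x) t (toℕ y) * offset (zero {suc k}) (suc (suc k)) * fac k ∎
    where
    Lx = ⟦ toℕ x ℕ.<? t ⟧
    Ly = ⟦ toℕ y ℕ.<? t ⟧
    rest : ∀ v (v≢x : v ≢ x) (v≢y : v ≢ y) →
      ΣPerm (suc k) (λ w → below zero t (extend v w) * invSgn (punchOut v≢x) (punchOut v≢y) w) ≡ + 0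
    rest v v≢x v≢y = begin
      ΣPerm (suc k) (λ w → ⟦ toℕ v ℕ.<? t ⟧ * invSgn (punchOut v≢x) (punchOut v≢y) w)
        ≡⟨ ΣPerm-scale (suc k) ⟦ toℕ v ℕ.<? t ⟧ (invSgn (punchOut v≢x) (punchOut v≢y)) ⟩
      ⟦ toℕ v ℕ.<? t ⟧ * ΣPerm (suc k) (invSgn (punchOut v≢x) (punchOut v≢y))
        ≡⟨ cong (⟦ toℕ v ℕ.<? t ⟧ *_) (ΣPerm-invSgn (suc k) _ _ (FinP.<⇒≢ x<y ∘ FinP.punchOut-injective v≢x v≢y)) ⟩
      ⟦ toℕ v ℕ.<? t ⟧ * + 0
        ≡⟨ ℤP.*-zeroʳ ⟦ toℕ v ℕ.<? t ⟧ ⟩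
      + 0 ∎
    collect : ∀ lx ly k f → - (lx * ((+ 1 + k) * f)) + ly * ((+ 1 + k) * f) + (+ 0 - + 0 - + 0)
                          ≡ (lx - ly) * (+ 2 * + 0 + + 1 - (+ 2 + k)) * f
    collect = solve-∀

  offset-step : ∀ k (c : Fin (suc k)) i →
    i * fac k + + k * (i * offset c (suc k) * fac (k ∸ 1)) ≡ i * offset (suc c) (suc (suc k)) * fac k
  offset-step zero zero i = small i
    where small : ∀ i → i * + 1 + + 0 * (i * (+ 2 * + 0 + + 1 - + 1) * + 1) ≡ i * (+ 2 * + 1 + + 1 - + 2) * + 1
          small = solve-∀
  offset-step (suc j) c i = begin
    i * fac (suc j) + + suc j * (i * offset c (suc (suc j)) * fac j)
      ≡⟨ cong (λ f → i * f + + suc j * (i * offset c (suc (suc j)) * fac j)) (fac-suc j) ⟩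
    i * ((+ 1 + + j) * fac j) + (+ 1 + + j) * (i * (+ 2 * + toℕ c + + 1 - (+ 2 + + j)) * fac j)
      ≡⟨ large i (+ toℕ c) (+ j) (fac j) ⟩
    i * (+ 2 * (+ 1 + + toℕ c) + + 1 - (+ 3 + + j)) * ((+ 1 + + j) * fac j)
      ≡⟨ cong (λ f → i * offset (suc c) (suc (suc (suc j))) * f) (sym (fac-suc j)) ⟩
    i * offset (suc c) (suc (suc (suc j))) * fac (suc j) ∎
    where large : ∀ i c j f → i * ((+ 1 + j) * f) + (+ 1 + j) * (i * (+ 2 * c + + 1 - (+ 2 + j)) * f)
                            ≡ i * (+ 2 * (+ 1 + c) + + 1 - (+ 3 + j)) * ((+ 1 + j) * f)
          large = solve-∀

  ΣPerm-below-invSgn : ∀ n (c : Fin n) t (x y : Fin n) → x Fin.< y → t ℕ.≤ n →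
    ΣPerm n (λ σ → below c t σ * invSgn x y σ) ≡ between (toℕ x) t (toℕ y) * offset c n * fac (n ∸ 2)
  ΣPerm-below-invSgn (suc zero) zero t zero zero ()
  ΣPerm-below-invSgn (suc (suc k)) zero t x y x<y _ = ΣPerm-below₀-invSgn k t x y x<y
  ΣPerm-below-invSgn (suc (suc k)) (suc c) t x y x<y t≤ = begin
    ΣPerm (suc (suc k)) (λ σ → below (suc c) t σ * invSgn x y σ)
      ≡⟨ ΣPerm-invSgn-expand (suc k) x y (FinP.<⇒≢ x<y) (below (suc c) t) (λ _ → C) rest ⟩
    - ΣPerm (suc k) (below (suc c) t ∘ extend x) + ΣPerm (suc k) (below (suc c) t ∘ extend y)
      + (sum {suc (suc k)} (λ _ → C) - C - C)
      ≡⟨ cong₂ (λ p q → - p + q + (sum {suc (suc k)} (λ _ → C) - C - C)) (first x) (first y) ⟩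
    - ((+ t - Lx) * fac k) + (+ t - Ly) * fac k + (sum {suc (suc k)} (λ _ → C) - C - C)
      ≡⟨ cong (λ s → - ((+ t - Lx) * fac k) + (+ t - Ly) * fac k + (s - C - C)) (sum-const (suc (suc k)) C) ⟩
    - ((+ t - Lx) * fac k) + (+ t - Ly) * fac k + ((+ 2 + + k) * C - C - C)
      ≡⟨ collect (+ t) Lx Ly (fac k) (+ k) C ⟩
    (Lx - Ly) * fac k + + k * C
      ≡⟨ cong (λ i → i * fac k + + k * C) (sym (between-thresholds (toℕ x) t (toℕ y) x<y)) ⟩
    I * fac k + + k * (I * offset c (suc k) * fac (k ∸ 1))
      ≡⟨ offset-step k c I ⟩
    I * offset (suc c) (suc (suc k)) * fac k ∎
    where
    I = between (toℕ x) t (toℕ y)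
    C = I * offset c (suc k) * fac (k ∸ 1)
    Lx = ⟦ toℕ x ℕ.<? t ⟧
    Ly = ⟦ toℕ y ℕ.<? t ⟧
    first : ∀ u → ΣPerm (suc k) (below (suc c) t ∘ extend u) ≡ (+ t - ⟦ toℕ u ℕ.<? t ⟧) * fac k
    first u = begin
      ΣPerm (suc k) (below (suc c) t ∘ extend u)     ≡⟨ ΣPerm-cong (suc k) (λ w _ → below-extend u w c t) ⟩
      ΣPerm (suc k) (below c (punchOutℕ (toℕ u) t))  ≡⟨ ΣPerm-below k c (punchOutℕ (toℕ u) t) (punchOutℕ-bounded u t t≤) ⟩
      + punchOutℕ (toℕ u) t * fac k                  ≡⟨ cong (_* fac k) (punchOutℕ-ℤ (toℕ u) t) ⟩
      (+ t - ⟦ toℕ u ℕ.<? t ⟧) * fac k               ∎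
    rest : ∀ v (v≢x : v ≢ x) (v≢y : v ≢ y) →
      ΣPerm (suc k) (λ w → below (suc c) t (extend v w) * invSgn (punchOut v≢x) (punchOut v≢y) w) ≡ C
    rest v v≢x v≢y = begin
      ΣPerm (suc k) (λ w → below (suc c) t (extend v w) * invSgn (punchOut v≢x) (punchOut v≢y) w)
        ≡⟨ ΣPerm-cong (suc k) (λ w _ → cong (_* invSgn (punchOut v≢x) (punchOut v≢y) w) (below-extend v w c t)) ⟩
      ΣPerm (suc k) (λ w → below c (punchOutℕ (toℕ v) t) w * invSgn (punchOut v≢x) (punchOut v≢y) w)
        ≡⟨ ΣPerm-below-invSgn (suc k) c (punchOutℕ (toℕ v) t) (punchOut v≢x) (punchOut v≢y)
             (punchOut-mono-< v≢x v≢y x<y) (punchOutℕ-bounded v t t≤) ⟩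
      between (toℕ (punchOut v≢x)) (punchOutℕ (toℕ v) t) (toℕ (punchOut v≢y)) * offset c (suc k) * fac (k ∸ 1)
        ≡⟨ cong₂ (λ a b → between a (punchOutℕ (toℕ v) t) b * offset c (suc k) * fac (k ∸ 1))
                 (toℕ-punchOut v≢x) (toℕ-punchOut v≢y) ⟩
      between (punchOutℕ (toℕ v) (toℕ x)) (punchOutℕ (toℕ v) t) (punchOutℕ (toℕ v) (toℕ y))
        * offset c (suc k) * fac (k ∸ 1)
        ≡⟨ cong (λ i → i * offset c (suc k) * fac (k ∸ 1))
                (between-punchOutℕ (toℕ v) (toℕ x) t (toℕ y) (toℕ-≢ (v≢x ∘ sym)) (toℕ-≢ (v≢y ∘ sym))) ⟩
      C ∎
    collect : ∀ t lx ly f k c → - ((t - lx) * f) + (t - ly) * f + ((+ 2 + k) * c - c - c) ≡ (lx - ly) * f + k * c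
    collect = solve-∀

  -- The main correlation  Σ_σ sgn a b (σ) · invSgn x y (σ)

  monus-ℤ : ∀ a b → b ℕ.< a → + (a ∸ b ∸ 1) ≡ + a - + b - + 1
  monus-ℤ (suc a) zero _ = shift (+ a)
    where shift : ∀ a → a ≡ (+ 1 + a) - + 0 - + 1
          shift = solve-∀
  monus-ℤ (suc a) (suc b) (s≤s b<a) = trans (monus-ℤ a b b<a) (shift (+ a) (+ b))
    where shift : ∀ a b → a - b - + 1 ≡ (+ 1 + a) - (+ 1 + b) - + 1
          shift = solve-∀

  χ-ℤ : ∀ {n} {x y : Fin n} → x Fin.< y → + χ x y ≡ + toℕ y - + toℕ x - + 1
  χ-ℤ {x = x} {y} x<y = monus-ℤ (toℕ y) (toℕ x) x<y

  χ-adjacent : ∀ (x y : Fin 2) → x Fin.< y → χ x y ≡ 0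
  χ-adjacent zero (suc zero) _ = refl
  χ-adjacent (suc zero) (suc zero) (s≤s ())

  χ-punchOut : ∀ {n} {v x y : Fin (suc n)} (v≢x : v ≢ x) (v≢y : v ≢ y) → x Fin.< y →
    + χ (punchOut v≢x) (punchOut v≢y) ≡ + χ x y - (⟦ toℕ v ℕ.<? toℕ y ⟧ - ⟦ toℕ v ℕ.<? suc (toℕ x) ⟧)
  χ-punchOut {v = v} {x} {y} v≢x v≢y x<y = begin
    + χ (punchOut v≢x) (punchOut v≢y)
      ≡⟨ χ-ℤ (punchOut-mono-< v≢x v≢y x<y) ⟩
    + toℕ (punchOut v≢y) - + toℕ (punchOut v≢x) - + 1
      ≡⟨ cong₂ (λ p q → + p - + q - + 1) (toℕ-punchOut v≢y) (toℕ-punchOut v≢x) ⟩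
    + punchOutℕ (toℕ v) (toℕ y) - + punchOutℕ (toℕ v) (toℕ x) - + 1
      ≡⟨ cong₂ (λ p q → p - q - + 1) (punchOutℕ-ℤ (toℕ v) (toℕ y)) (punchOutℕ-ℤ (toℕ v) (toℕ x)) ⟩
    (+ toℕ y - ⟦ toℕ v ℕ.<? toℕ y ⟧) - (+ toℕ x - ⟦ toℕ v ℕ.<? toℕ x ⟧) - + 1
      ≡⟨ cong (λ l → (+ toℕ y - ⟦ toℕ v ℕ.<? toℕ y ⟧) - (+ toℕ x - l) - + 1) v<x⇔v<x+1 ⟩
    (+ toℕ y - ⟦ toℕ v ℕ.<? toℕ y ⟧) - (+ toℕ x - ⟦ toℕ v ℕ.<? suc (toℕ x) ⟧) - + 1
      ≡⟨ regroup (+ toℕ y) (+ toℕ x) ⟦ toℕ v ℕ.<? toℕ y ⟧ ⟦ toℕ v ℕ.<? suc (toℕ x) ⟧ ⟩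
    (+ toℕ y - + toℕ x - + 1) - (⟦ toℕ v ℕ.<? toℕ y ⟧ - ⟦ toℕ v ℕ.<? suc (toℕ x) ⟧)
      ≡⟨ cong (_- (⟦ toℕ v ℕ.<? toℕ y ⟧ - ⟦ toℕ v ℕ.<? suc (toℕ x) ⟧)) (sym (χ-ℤ x<y)) ⟩
    + χ x y - (⟦ toℕ v ℕ.<? toℕ y ⟧ - ⟦ toℕ v ℕ.<? suc (toℕ x) ⟧) ∎
    where
    v<x⇔v<x+1 : ⟦ toℕ v ℕ.<? toℕ x ⟧ ≡ ⟦ toℕ v ℕ.<? suc (toℕ x) ⟧
    v<x⇔v<x+1 = ⟦⟧-⇔ _ _ ℕP.m<n⇒m<1+n (λ h → ℕP.≤∧≢⇒< (ℕP.≤-pred h) (toℕ-≢ v≢x))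
    regroup : ∀ y x a b → (y - a) - (x - b) - + 1 ≡ (y - x - + 1) - (a - b)
    regroup = solve-∀

  first-position-arithmetic : ∀ k (x y : Fin (suc (suc k))) → x Fin.< y → (b : Fin (suc k)) →
    - (+ 2 * (+ toℕ x * fac k) - fac (suc k)) + (+ 2 * (+ toℕ y * fac k) - fac (suc k))
      + (+ 2 * offset b (suc k) * fac (k ∸ 1) * (+ suc (toℕ y) - + suc (toℕ x)) - + 0
         - + 2 * (+ 1 * offset b (suc k) * fac (k ∸ 1)))
    ≡ + 2 * fac k + + 4 * + χ x y * + toℕ b * fac (k ∸ 1)
  first-position-arithmetic zero x y x<y zero = begin
    _ ≡⟨ small (+ toℕ y) (+ toℕ x) ⟩
    + 2 + + 2 * (+ toℕ y - + toℕ x - + 1)    ≡⟨ cong (λ z → + 2 + + 2 * z) (trans (sym (χ-ℤ x<y)) (cong +_ (χ-adjacent x y x<y))) ⟩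
    + 2 * + 1 + + 4 * + 0 * + 0 * + 1        ≡⟨ cong (λ c → + 2 * + 1 + + 4 * + c * + 0 * + 1) (sym (χ-adjacent x y x<y)) ⟩
    + 2 * + 1 + + 4 * + χ x y * + 0 * + 1    ∎
    where small : ∀ y x → - (+ 2 * (x * + 1) - + 1) + (+ 2 * (y * + 1) - + 1)
                            + (+ 2 * (+ 2 * + 0 + + 1 - + 1) * + 1 * ((+ 1 + y) - (+ 1 + x)) - + 0
                               - + 2 * (+ 1 * (+ 2 * + 0 + + 1 - + 1) * + 1))
                          ≡ + 2 + + 2 * (y - x - + 1)
          small = solve-∀
  first-position-arithmetic (suc j) x y x<y b = begin
    _ ≡⟨ cong₂ (λ f g → - (+ 2 * (+ toℕ x * f) - g) + (+ 2 * (+ toℕ y * f) - g)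
                         + (+ 2 * offset b (suc (suc j)) * fac j * (+ suc (toℕ y) - + suc (toℕ x)) - + 0
                            - + 2 * (+ 1 * offset b (suc (suc j)) * fac j)))
               (fac-suc j) (trans (fac-suc (suc j)) (cong ((+ 2 + + j) *_) (fac-suc j))) ⟩
    _ ≡⟨ large (+ toℕ y) (+ toℕ x) (+ toℕ b) (+ j) (fac j) ⟩
    + 2 * ((+ 1 + + j) * fac j) + + 4 * (+ toℕ y - + toℕ x - + 1) * + toℕ b * fac j
      ≡⟨ cong₂ (λ f z → + 2 * f + + 4 * z * + toℕ b * fac j) (sym (fac-suc j)) (sym (χ-ℤ x<y)) ⟩
    + 2 * fac (suc j) + + 4 * + χ x y * + toℕ b * fac j ∎
    where large : ∀ y x b j f →
                    - (+ 2 * (x * ((+ 1 + j) * f)) - (+ 2 + j) * ((+ 1 + j) * f))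
                    + (+ 2 * (y * ((+ 1 + j) * f)) - (+ 2 + j) * ((+ 1 + j) * f))
                    + (+ 2 * (+ 2 * b + + 1 - (+ 2 + j)) * f * ((+ 1 + y) - (+ 1 + x)) - + 0
                       - + 2 * (+ 1 * (+ 2 * b + + 1 - (+ 2 + j)) * f))
                  ≡ + 2 * ((+ 1 + j) * f) + + 4 * (y - x - + 1) * b * f
          large = solve-∀

  -- The case a = 0 (note χ_{0,b+1} = b): expand by the first letter v; the sign of σ(0) − σ(b+1)
  -- becomes 2·[σ(b+1) < v] − 1, reducing to the auxiliary correlation.
  ΣPerm-sgn₀-invSgn : ∀ k (b : Fin (suc k)) (x y : Fin (suc (suc k))) → x Fin.< y →
    ΣPerm (suc (suc k)) (λ σ → sgn zero (suc b) σ * invSgn x y σ) ≡ + 2 * fac k + + 4 * + χ x y * + toℕ b * fac (k ∸ 1)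
  ΣPerm-sgn₀-invSgn k b x y x<y = begin
    ΣPerm (suc (suc k)) (λ σ → sgn zero (suc b) σ * invSgn x y σ)
      ≡⟨ ΣPerm-invSgn-expand (suc k) x y (FinP.<⇒≢ x<y) (sgn zero (suc b)) C rest ⟩
    - ΣPerm (suc k) (sgn zero (suc b) ∘ extend x) + ΣPerm (suc k) (sgn zero (suc b) ∘ extend y) + (sum C - C x - C y)
      ≡⟨ cong₂ (λ p q → - p + q + (sum C - C x - C y)) (ΣPerm-sgn-first k x b) (ΣPerm-sgn-first k y b) ⟩
    - first x + first y + (sum C - C x - C y)
      ≡⟨ cong₂ (λ s c → - first x + first y + (s - c - C y)) sum-C C-x ⟩
    - first x + first y + (+ 2 * K * F * (+ suc (toℕ y) - + suc (toℕ x)) - + 0 - C y)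
      ≡⟨ cong (λ c → - first x + first y + (+ 2 * K * F * (+ suc (toℕ y) - + suc (toℕ x)) - + 0 - c)) C-y ⟩
    - first x + first y + (+ 2 * K * F * (+ suc (toℕ y) - + suc (toℕ x)) - + 0 - + 2 * (+ 1 * K * F))
      ≡⟨ first-position-arithmetic k x y x<y b ⟩
    + 2 * fac k + + 4 * + χ x y * + toℕ b * fac (k ∸ 1) ∎
    where
    K = offset b (suc k)
    F = fac (k ∸ 1)
    first : Fin (suc (suc k)) → ℤ
    first u = + 2 * (+ toℕ u * fac k) - fac (suc k)
    C : Fin (suc (suc k)) → ℤ
    C v = + 2 * (between (toℕ x) (toℕ v) (toℕ y) * K * F)
    rest : ∀ v (v≢x : v ≢ x) (v≢y : v ≢ y) →
      ΣPerm (suc k) (λ w → sgn zero (suc b) (extend v w) * invSgn (punchOut v≢x) (punchOut v≢y) w) ≡ C v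
    rest v v≢x v≢y = begin
      ΣPerm (suc k) (λ w → sgn zero (suc b) (extend v w) * s w)
        ≡⟨ ΣPerm-cong (suc k) (λ w _ → trans (cong (_* s w) (sgn-extend-first v w b)) (expand (below b (toℕ v) w) (s w))) ⟩
      ΣPerm (suc k) (λ w → + 2 * (below b (toℕ v) w * s w) + - + 1 * s w)
        ≡⟨ ΣPerm-+ (suc k) (λ w → + 2 * (below b (toℕ v) w * s w)) (λ w → - + 1 * s w) ⟩
      ΣPerm (suc k) (λ w → + 2 * (below b (toℕ v) w * s w)) + ΣPerm (suc k) (λ w → - + 1 * s w)
        ≡⟨ cong₂ _+_ (ΣPerm-scale (suc k) (+ 2) (λ w → below b (toℕ v) w * s w)) (ΣPerm-scale (suc k) (- + 1) s) ⟩
      + 2 * ΣPerm (suc k) (λ w → below b (toℕ v) w * s w) + - + 1 * ΣPerm (suc k) s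
        ≡⟨ cong₂ (λ p q → + 2 * p + - + 1 * q)
             (ΣPerm-below-invSgn (suc k) b (toℕ v) (punchOut v≢x) (punchOut v≢y)
                (punchOut-mono-< v≢x v≢y x<y) (ℕP.≤-pred (FinP.toℕ<n v)))
             (ΣPerm-invSgn (suc k) _ _ (FinP.<⇒≢ x<y ∘ FinP.punchOut-injective v≢x v≢y)) ⟩
      + 2 * (between (toℕ (punchOut v≢x)) (toℕ v) (toℕ (punchOut v≢y)) * K * F) + - + 1 * + 0
        ≡⟨ ℤP.+-identityʳ _ ⟩
      + 2 * (between (toℕ (punchOut v≢x)) (toℕ v) (toℕ (punchOut v≢y)) * K * F)
        ≡⟨ cong (λ i → + 2 * (i * K * F)) renumbered ⟩
      C v ∎
      where
      s = invSgn (punchOut v≢x) (punchOut v≢y)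
      expand : ∀ l s → (+ 2 * l - + 1) * s ≡ + 2 * (l * s) + - + 1 * s
      expand = solve-∀
      renumbered : between (toℕ (punchOut v≢x)) (toℕ v) (toℕ (punchOut v≢y)) ≡ between (toℕ x) (toℕ v) (toℕ y)
      renumbered = begin
        between (toℕ (punchOut v≢x)) (toℕ v) (toℕ (punchOut v≢y))
          ≡⟨ cong₂ (λ p q → between p (toℕ v) q) (toℕ-punchOut v≢x) (toℕ-punchOut v≢y) ⟩
        between (punchOutℕ (toℕ v) (toℕ x)) (toℕ v) (punchOutℕ (toℕ v) (toℕ y))
          ≡⟨ cong (λ t → between (punchOutℕ (toℕ v) (toℕ x)) t (punchOutℕ (toℕ v) (toℕ y))) (sym (punchOutℕ-self (toℕ v))) ⟩
        between (punchOutℕ (toℕ v) (toℕ x)) (punchOutℕ (toℕ v) (toℕ v)) (punchOutℕ (toℕ v) (toℕ y))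
          ≡⟨ between-punchOutℕ (toℕ v) (toℕ x) (toℕ v) (toℕ y) (toℕ-≢ (v≢x ∘ sym)) (toℕ-≢ (v≢y ∘ sym)) ⟩
        between (toℕ x) (toℕ v) (toℕ y) ∎
    sum-C : sum C ≡ + 2 * K * F * (+ suc (toℕ y) - + suc (toℕ x))
    sum-C = begin
      sum C
        ≡⟨ sum-cong-≗ {suc (suc k)} (λ v → trans (cong (λ i → + 2 * (i * K * F)) (between-points (toℕ x) (toℕ v) (toℕ y) x<y))
                                                (reorder (⟦ toℕ v ℕ.<? suc (toℕ y) ⟧ - ⟦ toℕ v ℕ.<? suc (toℕ x) ⟧) K F)) ⟩
      sum {suc (suc k)} (λ v → + 2 * K * F * (⟦ toℕ v ℕ.<? suc (toℕ y) ⟧ - ⟦ toℕ v ℕ.<? suc (toℕ x) ⟧))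
        ≡⟨ count-window (suc (suc k)) (+ 2 * K * F) (suc (toℕ x)) (suc (toℕ y)) (FinP.toℕ<n x) (FinP.toℕ<n y) ⟩
      + 2 * K * F * (+ suc (toℕ y) - + suc (toℕ x)) ∎
      where reorder : ∀ i k f → + 2 * (i * k * f) ≡ + 2 * k * f * i
            reorder = solve-∀
    C-x : C x ≡ + 0
    C-x rewrite ⟦⟧-no (toℕ x ℕ.<? toℕ x) (ℕP.<-irrefl refl) = refl
    C-y : C y ≡ + 2 * (+ 1 * K * F)
    C-y rewrite ⟦⟧-yes (toℕ x ℕ.<? toℕ y) x<y | ⟦⟧-yes (toℕ y ℕ.≤? toℕ y) ℕP.≤-refl = refl

  later-position-arithmetic : ∀ j X (a b : Fin (suc (suc j))) → a Fin.< b →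
    (+ 1 + + j) * (+ 2 * fac j + + 4 * X * + χ a b * fac (j ∸ 1)) + - (+ 4 * + χ a b * fac (j ∸ 1)) * X
      ≡ + 2 * fac (suc j) + + 4 * X * + χ a b * fac j
  later-position-arithmetic zero X a b a<b rewrite χ-adjacent a b a<b = small X
    where small : ∀ x → (+ 1 + + 0) * (+ 2 * + 1 + + 4 * x * + 0 * + 1) + - (+ 4 * + 0 * + 1) * x
                         ≡ + 2 * + 1 + + 4 * x * + 0 * + 1
          small = solve-∀
  later-position-arithmetic (suc i) X a b a<b = begin
    (+ 2 + + i) * (+ 2 * fac (suc i) + + 4 * X * + χ a b * fac i) + - (+ 4 * + χ a b * fac i) * X
      ≡⟨ cong (λ f → (+ 2 + + i) * (+ 2 * f + + 4 * X * + χ a b * fac i) + - (+ 4 * + χ a b * fac i) * X) (fac-suc i) ⟩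
    (+ 2 + + i) * (+ 2 * ((+ 1 + + i) * fac i) + + 4 * X * + χ a b * fac i) + - (+ 4 * + χ a b * fac i) * X
      ≡⟨ large (+ i) X (+ χ a b) (fac i) ⟩
    + 2 * ((+ 2 + + i) * ((+ 1 + + i) * fac i)) + + 4 * X * + χ a b * ((+ 1 + + i) * fac i)
      ≡⟨ cong₂ (λ f g → + 2 * f + + 4 * X * + χ a b * g)
               (sym (trans (fac-suc (suc i)) (cong ((+ 2 + + i) *_) (fac-suc i)))) (sym (fac-suc i)) ⟩
    + 2 * fac (suc (suc i)) + + 4 * X * + χ a b * fac (suc i) ∎
    where large : ∀ i x y f → (+ 2 + i) * (+ 2 * ((+ 1 + i) * f) + + 4 * x * y * f) + - (+ 4 * y * f) * x
                                ≡ + 2 * ((+ 2 + i) * ((+ 1 + i) * f)) + + 4 * x * y * ((+ 1 + i) * f)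
          large = solve-∀

  -- Σ_σ sgn a b (σ)·invSgn x y (σ) = 2(n−2)! + 4 χ_{x,y} χ_{a,b} (n−3)!   (a < b, x < y), by induction on a:
  -- for a > 0 the first letter v only renumbers x, y, which changes χ_{x,y} by [x < v < y].
  ΣPerm-sgn-invSgn : ∀ n (a b x y : Fin n) → a Fin.< b → x Fin.< y →
    ΣPerm n (λ σ → sgn a b σ * invSgn x y σ) ≡ + 2 * fac (n ∸ 2) + + 4 * + χ x y * + χ a b * fac (n ∸ 3)
  ΣPerm-sgn-invSgn (suc (suc k)) zero (suc b) x y _ x<y = ΣPerm-sgn₀-invSgn k b x y x<y
  ΣPerm-sgn-invSgn (suc (suc (suc j))) (suc a) (suc b) x y (s≤s a<b) x<y = begin
    ΣPerm N (λ σ → sgn (suc a) (suc b) σ * invSgn x y σ)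
      ≡⟨ ΣPerm-invSgn-expand (suc (suc j)) x y (FinP.<⇒≢ x<y) (sgn (suc a) (suc b)) C rest ⟩
    - ΣPerm (suc (suc j)) (sgn (suc a) (suc b) ∘ extend x) + ΣPerm (suc (suc j)) (sgn (suc a) (suc b) ∘ extend y)
      + (sum C - C x - C y)
      ≡⟨ cong₂ (λ p q → - p + q + (sum C - C x - C y)) (balanced x) (balanced y) ⟩
    - + 0 + + 0 + (sum C - C x - C y)
      ≡⟨ cong₂ (λ s c → - + 0 + + 0 + (s - c - C y)) sum-C (C-at x inGap-x) ⟩
    - + 0 + + 0 + (+ N * P + c * (+ toℕ y - + suc (toℕ x)) - P - C y)
      ≡⟨ cong (λ z → - + 0 + + 0 + (+ N * P + c * (+ toℕ y - + suc (toℕ x)) - P - z)) (C-at y inGap-y) ⟩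
    - + 0 + + 0 + (+ N * P + c * (+ toℕ y - + suc (toℕ x)) - P - P)
      ≡⟨ collect (+ j) P c (+ toℕ y) (+ toℕ x) ⟩
    (+ 1 + + j) * P + c * (+ toℕ y - + toℕ x - + 1)
      ≡⟨ cong (λ z → (+ 1 + + j) * P + c * z) (sym (χ-ℤ x<y)) ⟩
    (+ 1 + + j) * P + c * X
      ≡⟨ later-position-arithmetic j X a b a<b ⟩
    + 2 * fac (suc j) + + 4 * X * + χ a b * fac j ∎
    where
    N = suc (suc (suc j))
    X = + χ x y
    Y = + χ a b
    P = + 2 * fac j + + 4 * X * Y * fac (j ∸ 1)
    c = - (+ 4 * Y * fac (j ∸ 1))
    -- inGap v = 1 exactly when x < v < y, i.e. when removing v brings x and y closer.
    inGap : Fin N → ℤ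
    inGap v = ⟦ toℕ v ℕ.<? toℕ y ⟧ - ⟦ toℕ v ℕ.<? suc (toℕ x) ⟧
    C : Fin N → ℤ
    C v = + 2 * fac j + + 4 * (X - inGap v) * Y * fac (j ∸ 1)
    balanced : ∀ u → ΣPerm (suc (suc j)) (sgn (suc a) (suc b) ∘ extend u) ≡ + 0
    balanced u = trans (ΣPerm-cong (suc (suc j)) (λ w _ → sgn-extend u w a b)) (ΣPerm-sgn (suc (suc j)) a b a<b)
    rest : ∀ v (v≢x : v ≢ x) (v≢y : v ≢ y) →
      ΣPerm (suc (suc j)) (λ w → sgn (suc a) (suc b) (extend v w) * invSgn (punchOut v≢x) (punchOut v≢y) w) ≡ C v
    rest v v≢x v≢y = begin
      ΣPerm (suc (suc j)) (λ w → sgn (suc a) (suc b) (extend v w) * invSgn (punchOut v≢x) (punchOut v≢y) w)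
        ≡⟨ ΣPerm-cong (suc (suc j)) (λ w _ → cong (_* invSgn (punchOut v≢x) (punchOut v≢y) w) (sgn-extend v w a b)) ⟩
      ΣPerm (suc (suc j)) (λ w → sgn a b w * invSgn (punchOut v≢x) (punchOut v≢y) w)
        ≡⟨ ΣPerm-sgn-invSgn (suc (suc j)) a b (punchOut v≢x) (punchOut v≢y) a<b (punchOut-mono-< v≢x v≢y x<y) ⟩
      + 2 * fac j + + 4 * + χ (punchOut v≢x) (punchOut v≢y) * Y * fac (j ∸ 1)
        ≡⟨ cong (λ z → + 2 * fac j + + 4 * z * Y * fac (j ∸ 1)) (χ-punchOut v≢x v≢y x<y) ⟩
      C v ∎
    C-linear : ∀ v → C v ≡ P + c * inGap v
    C-linear v = linear (fac j) X Y (fac (j ∸ 1)) (inGap v)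
      where linear : ∀ f x y g i → + 2 * f + + 4 * (x - i) * y * g ≡ (+ 2 * f + + 4 * x * y * g) + - (+ 4 * y * g) * i
            linear = solve-∀
    C-at : ∀ v → inGap v ≡ + 0 → C v ≡ P
    C-at v gap≡0 = trans (C-linear v) (trans (cong (λ i → P + c * i) gap≡0) (drop P c))
      where drop : ∀ p c → p + c * + 0 ≡ p
            drop = solve-∀
    inGap-x : inGap x ≡ + 0
    inGap-x rewrite ⟦⟧-yes (toℕ x ℕ.<? toℕ y) x<y | ⟦⟧-yes (toℕ x ℕ.<? suc (toℕ x)) ℕP.≤-refl = refl
    inGap-y : inGap y ≡ + 0
    inGap-y rewrite ⟦⟧-no (toℕ y ℕ.<? toℕ y) (ℕP.<-irrefl refl)
              | ⟦⟧-no (toℕ y ℕ.<? suc (toℕ x)) (λ h → ℕP.<-irrefl refl (ℕP.<-≤-trans x<y (ℕP.≤-pred h))) = refl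
    sum-C : sum C ≡ + N * P + c * (+ toℕ y - + suc (toℕ x))
    sum-C = begin
      sum C                                          ≡⟨ sum-cong-≗ {N} C-linear ⟩
      sum {N} (λ v → P + c * inGap v)                    ≡⟨ ∑-distrib-+ {N} (λ _ → P) (λ v → c * inGap v) ⟩
      sum {N} (λ _ → P) + sum {N} (λ v → c * inGap v)    ≡⟨ cong₂ _+_ (sum-const N P)
                                                          (count-window N c (suc (toℕ x)) (toℕ y) (FinP.toℕ<n x)
                                                                        (ℕP.<⇒≤ (FinP.toℕ<n y))) ⟩
      + N * P + c * (+ toℕ y - + suc (toℕ x))        ∎
    collect : ∀ j p c y x → - + 0 + + 0 + ((+ 3 + j) * p + c * (y - (+ 1 + x)) - p - p) ≡ (+ 1 + j) * p + c * (y - x - + 1)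
    collect = solve-∀
  ΣPerm-sgn-invSgn (suc (suc zero)) (suc zero) (suc zero) x y (s≤s ()) x<y
  ΣPerm-sgn-invSgn (suc n) zero zero x y () x<y
  ΣPerm-sgn-invSgn (suc n) (suc a) zero x y () x<y

  -- The enumeration 'Sn' of Defs computes ΣPerm

  sumList : {A : Set} → List A → (A → ℤ) → ℤ
  sumList [] g = + 0
  sumList (a ∷ as) g = g a + sumList as g

  sumList-++ : {A : Set} (as bs : List A) (g : A → ℤ) → sumList (as List.++ bs) g ≡ sumList as g + sumList bs g
  sumList-++ [] bs g = sym (ℤP.+-identityˡ _)
  sumList-++ (a ∷ as) bs g = trans (cong (_+_ (g a)) (sumList-++ as bs g)) (sym (ℤP.+-assoc (g a) _ _))

  sumList-map : {A B : Set} (h : A → B) (as : List A) (g : B → ℤ) → sumList (List.map h as) g ≡ sumList as (g ∘ h)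
  sumList-map h [] g = refl
  sumList-map h (a ∷ as) g = cong (_+_ (g (h a))) (sumList-map h as g)

  sumList-concatMap : {A B : Set} (h : A → List B) (as : List A) (g : B → ℤ) →
    sumList (concatMap h as) g ≡ sumList as (λ a → sumList (h a) g)
  sumList-concatMap h [] g = refl
  sumList-concatMap h (a ∷ as) g =
    trans (sumList-++ (h a) (concatMap h as) g) (cong (_+_ (sumList (h a) g)) (sumList-concatMap h as g))

  sumList-tabulate : {A : Set} → ∀ n (h : Fin n → A) (g : A → ℤ) → sumList (List.tabulate h) g ≡ sum (g ∘ h)
  sumList-tabulate zero h g = refl
  sumList-tabulate (suc n) h g = cong (_+_ (g (h zero))) (sumList-tabulate n (h ∘ suc) g)

  length-filter : {A : Set} {Q : Pred A _} (Q? : Decidable Q) (as : List A) →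
    + List.length (filter Q? as) ≡ sumList as (λ a → ⟦ Q? a ⟧)
  length-filter Q? [] = refl
  length-filter Q? (a ∷ as) with Q? a
  ... | yes _ = cong (_+_ (+ 1)) (length-filter Q? as)
  ... | no _ = trans (length-filter Q? as) (sym (ℤP.+-identityˡ _))

  sumList-filter : {A : Set} {Q : Pred A _} (Q? : Decidable Q) (as : List A) (g : A → ℤ) →
    sumList (filter Q? as) g ≡ sumList as (λ a → ⟦ Q? a ⟧ * g a)
  sumList-filter Q? [] g = refl
  sumList-filter Q? (a ∷ as) g with Q? a
  ... | yes _ = cong₂ _+_ (sym (ℤP.*-identityˡ (g a))) (sumList-filter Q? as g)
  ... | no _ = trans (sumList-filter Q? as g) (sym (ℤP.+-identityˡ _))

  ΣWords : ∀ k m → (Vec (Fin k) m → ℤ) → ℤ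
  ΣWords k zero g = g []
  ΣWords k (suc m) g = sum (λ x → ΣWords k m (g ∘ (x ∷_)))

  sumList-allVecs : ∀ k m (g : Vec (Fin k) m → ℤ) → sumList (allVecs k m) g ≡ ΣWords k m g
  sumList-allVecs k zero g = ℤP.+-identityʳ (g [])
  sumList-allVecs k (suc m) g = begin
    sumList (concatMap (λ x → List.map (x ∷_) (allVecs k m)) (List.allFin k)) g
      ≡⟨ sumList-concatMap _ (List.allFin k) g ⟩
    sumList (List.allFin k) (λ x → sumList (List.map (x ∷_) (allVecs k m)) g)
      ≡⟨ sumList-tabulate k id _ ⟩
    sum (λ x → sumList (List.map (x ∷_) (allVecs k m)) g)
      ≡⟨ sum-cong-≗ {k} (λ x → trans (sumList-map (x ∷_) (allVecs k m) g) (sumList-allVecs k m (g ∘ (x ∷_)))) ⟩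
    sum (λ x → ΣWords k m (g ∘ (x ∷_))) ∎

  ΣWords-cong : ∀ k m {f g : Vec (Fin k) m → ℤ} → (∀ w → f w ≡ g w) → ΣWords k m f ≡ ΣWords k m g
  ΣWords-cong k zero agree = agree []
  ΣWords-cong k (suc m) agree = sum-cong-≗ {k} (λ x → ΣWords-cong k m (agree ∘ (x ∷_)))

  ΣWords-scale : ∀ k m c (f : Vec (Fin k) m → ℤ) → ΣWords k m (λ w → c * f w) ≡ c * ΣWords k m f
  ΣWords-scale k zero c f = refl
  ΣWords-scale k (suc m) c f = trans (sum-cong-≗ {k} (λ x → ΣWords-scale k m c (f ∘ (x ∷_))))
                                     (sum-scale {k} c (λ x → ΣWords k m (f ∘ (x ∷_))))

  fresh : ∀ {k m} → Fin k → Vec (Fin k) m → Bool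
  fresh x [] = true
  fresh x (y ∷ w) = not (does (x FinP.≟ y)) ∧ fresh x w

  distinct : ∀ {k m} → Vec (Fin k) m → Bool
  distinct [] = true
  distinct (x ∷ w) = fresh x w ∧ distinct w

  ⟦≢⟧ : ∀ {k} (x y : Fin k) → x ≢ y → ⟦ not (does (x FinP.≟ y)) ⟧ᵇ ≡ + 1
  ⟦≢⟧ x y x≢y with x FinP.≟ y
  ... | yes x≡y = contradiction x≡y x≢y
  ... | no _ = refl

  ⟦≢⟧-refl : ∀ {k} (x : Fin k) → ⟦ not (does (x FinP.≟ x)) ⟧ᵇ ≡ + 0
  ⟦≢⟧-refl x with x FinP.≟ x
  ... | yes _ = refl
  ... | no x≢x = contradiction refl x≢x

  -- The words over [k+1] avoiding x are the punchIn x-images of the words over [k].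
  ΣWords-fresh : ∀ k m (x : Fin (suc k)) (G : Vec (Fin (suc k)) m → ℤ) →
    ΣWords (suc k) m (λ w → ⟦ fresh x w ⟧ᵇ * G w) ≡ ΣWords k m (G ∘ Vec.map (punchIn x))
  ΣWords-fresh k zero x G = ℤP.*-identityˡ (G [])
  ΣWords-fresh k (suc m) x G = begin
    sum (λ y → ΣWords (suc k) m (λ w → ⟦ not (does (x FinP.≟ y)) ∧ fresh x w ⟧ᵇ * G (y ∷ w)))
      ≡⟨ sum-cong-≗ {suc k} (λ y → trans (ΣWords-cong (suc k) m (λ w → split y w))
                                          (ΣWords-scale (suc k) m (avoid y) (λ w → ⟦ fresh x w ⟧ᵇ * G (y ∷ w)))) ⟩
    sum (λ y → avoid y * rest y)
      ≡⟨ sum-remove {i = x} (λ y → avoid y * rest y) ⟩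
    avoid x * rest x + sum (λ z → avoid (punchIn x z) * rest (punchIn x z))
      ≡⟨ cong₂ _+_ (cong (_* rest x) (⟦≢⟧-refl x))
                   (sum-cong-≗ {k} (λ z → trans (cong (_* rest (punchIn x z)) (⟦≢⟧ x (punchIn x z) (FinP.punchInᵢ≢i x z ∘ sym)))
                                                (ℤP.*-identityˡ (rest (punchIn x z))))) ⟩
    + 0 + sum (λ z → rest (punchIn x z))
      ≡⟨ ℤP.+-identityˡ _ ⟩
    sum (λ z → rest (punchIn x z))
      ≡⟨ sum-cong-≗ {k} (λ z → ΣWords-fresh k m x (G ∘ (punchIn x z ∷_))) ⟩
    sum (λ z → ΣWords k m (λ w → G (punchIn x z ∷ Vec.map (punchIn x) w))) ∎
    where
    avoid : Fin (suc k) → ℤ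
    avoid y = ⟦ not (does (x FinP.≟ y)) ⟧ᵇ
    rest : Fin (suc k) → ℤ
    rest y = ΣWords (suc k) m (λ w → ⟦ fresh x w ⟧ᵇ * G (y ∷ w))
    split : ∀ y w → ⟦ not (does (x FinP.≟ y)) ∧ fresh x w ⟧ᵇ * G (y ∷ w) ≡ avoid y * (⟦ fresh x w ⟧ᵇ * G (y ∷ w))
    split y w = trans (cong (_* G (y ∷ w)) (⟦∧⟧ (not (does (x FinP.≟ y))) (fresh x w)))
                      (ℤP.*-assoc (avoid y) ⟦ fresh x w ⟧ᵇ (G (y ∷ w)))

  fresh-punchIn : ∀ {k m} (x : Fin (suc k)) a (w : Vec (Fin k) m) →
    fresh (punchIn x a) (Vec.map (punchIn x) w) ≡ fresh a w
  fresh-punchIn x a [] = refl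
  fresh-punchIn x a (z ∷ w) = cong₂ (λ b c → not b ∧ c) (same-answer (punchIn x a FinP.≟ punchIn x z) (a FinP.≟ z))
                                                        (fresh-punchIn x a w)
    where
    same-answer : (d : Dec (punchIn x a ≡ punchIn x z)) (e : Dec (a ≡ z)) → does d ≡ does e
    same-answer (yes _) (yes _) = refl
    same-answer (yes p) (no ¬q) = contradiction (FinP.punchIn-injective x a z p) ¬q
    same-answer (no ¬p) (yes q) = contradiction (cong (punchIn x) q) ¬p
    same-answer (no _) (no _) = refl

  distinct-punchIn : ∀ {k m} (x : Fin (suc k)) (w : Vec (Fin k) m) → distinct (Vec.map (punchIn x) w) ≡ distinct w
  distinct-punchIn x [] = refl
  distinct-punchIn x (a ∷ w) = cong₂ _∧_ (fresh-punchIn x a w) (distinct-punchIn x w)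

  ΣWords-distinct : ∀ n (g : Word n → ℤ) → ΣWords n n (λ σ → ⟦ distinct σ ⟧ᵇ * g σ) ≡ ΣPerm n g
  ΣWords-distinct zero g = ℤP.*-identityˡ (g [])
  ΣWords-distinct (suc n) g = sum-cong-≗ {suc n} (λ v → begin
    ΣWords (suc n) n (λ w → ⟦ fresh v w ∧ distinct w ⟧ᵇ * g (v ∷ w))
      ≡⟨ ΣWords-cong (suc n) n (λ w → trans (cong (_* g (v ∷ w)) (⟦∧⟧ (fresh v w) (distinct w)))
                                            (ℤP.*-assoc ⟦ fresh v w ⟧ᵇ ⟦ distinct w ⟧ᵇ (g (v ∷ w)))) ⟩
    ΣWords (suc n) n (λ w → ⟦ fresh v w ⟧ᵇ * (⟦ distinct w ⟧ᵇ * g (v ∷ w)))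
      ≡⟨ ΣWords-fresh n n v (λ w → ⟦ distinct w ⟧ᵇ * g (v ∷ w)) ⟩
    ΣWords n n (λ w → ⟦ distinct (Vec.map (punchIn v) w) ⟧ᵇ * g (extend v w))
      ≡⟨ ΣWords-cong n n (λ w → cong (λ b → ⟦ b ⟧ᵇ * g (extend v w)) (distinct-punchIn v w)) ⟩
    ΣWords n n (λ w → ⟦ distinct w ⟧ᵇ * g (extend v w))
      ≡⟨ ΣWords-distinct n (g ∘ extend v) ⟩
    ΣPerm n (g ∘ extend v) ∎)

  LettersDistinct : ∀ {k m} → Vec (Fin k) m → Set
  LettersDistinct w = ∀ i j → lookup w i ≡ lookup w j → i ≡ j

  fresh-sound : ∀ {k m} (x : Fin k) (w : Vec (Fin k) m) → fresh x w ≡ true → ∀ j → lookup w j ≢ x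
  fresh-sound x (y ∷ w) e j with x FinP.≟ y
  fresh-sound x (y ∷ w) () j | yes _
  fresh-sound x (y ∷ w) e zero | no x≢y = x≢y ∘ sym
  fresh-sound x (y ∷ w) e (suc j) | no _ = fresh-sound x w e j

  fresh-complete : ∀ {k m} (x : Fin k) (w : Vec (Fin k) m) → (∀ j → lookup w j ≢ x) → fresh x w ≡ true
  fresh-complete x [] _ = refl
  fresh-complete x (y ∷ w) avoids with x FinP.≟ y
  ... | yes x≡y = contradiction (sym x≡y) (avoids zero)
  ... | no _ = fresh-complete x w (avoids ∘ suc)

  distinct-sound : ∀ {k m} (w : Vec (Fin k) m) → distinct w ≡ true → LettersDistinct w
  distinct-sound (x ∷ w) e zero zero _ = refl
  distinct-sound (x ∷ w) e zero (suc j) x≡wj = contradiction (sym x≡wj) (fresh-sound x w (BoolP.∧-conicalˡ _ _ e) j)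
  distinct-sound (x ∷ w) e (suc i) zero wi≡x = contradiction wi≡x (fresh-sound x w (BoolP.∧-conicalˡ _ _ e) i)
  distinct-sound (x ∷ w) e (suc i) (suc j) wi≡wj =
    cong suc (distinct-sound w (BoolP.∧-conicalʳ (fresh x w) _ e) i j wi≡wj)

  distinct-complete : ∀ {k m} (w : Vec (Fin k) m) → LettersDistinct w → distinct w ≡ true
  distinct-complete [] _ = refl
  distinct-complete (x ∷ w) inj =
    cong₂ _∧_ (fresh-complete x w (λ j e → FinP.0≢1+n (sym (inj (suc j) zero e))))
              (distinct-complete w (λ i j e → FinP.suc-injective (inj (suc i) (suc j) e)))

  ⟦isPerm?⟧ : ∀ {n} (σ : Word n) → ⟦ isPerm? σ ⟧ ≡ ⟦ distinct σ ⟧ᵇ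
  ⟦isPerm?⟧ σ with distinct σ in eq
  ... | true = ⟦⟧-yes (isPerm? σ) (distinct-sound σ eq)
  ... | false = ⟦⟧-no (isPerm? σ) (λ σ-perm → false≢true (trans (sym eq) (distinct-complete σ σ-perm)))
    where false≢true : false ≢ true
          false≢true ()

  count≡ΣPerm : ∀ n {P : Pred (Word n) _} (P? : Decidable P) → + count P? ≡ ΣPerm n (λ σ → ⟦ P? σ ⟧)
  count≡ΣPerm n P? = begin
    + List.length (filter P? (filter isPerm? (allVecs n n)))
      ≡⟨ length-filter P? (filter isPerm? (allVecs n n)) ⟩
    sumList (filter isPerm? (allVecs n n)) (λ σ → ⟦ P? σ ⟧)
      ≡⟨ sumList-filter isPerm? (allVecs n n) (λ σ → ⟦ P? σ ⟧) ⟩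
    sumList (allVecs n n) (λ σ → ⟦ isPerm? σ ⟧ * ⟦ P? σ ⟧)
      ≡⟨ sumList-allVecs n n _ ⟩
    ΣWords n n (λ σ → ⟦ isPerm? σ ⟧ * ⟦ P? σ ⟧)
      ≡⟨ ΣWords-cong n n (λ σ → cong (_* ⟦ P? σ ⟧) (⟦isPerm?⟧ σ)) ⟩
    ΣWords n n (λ σ → ⟦ distinct σ ⟧ᵇ * ⟦ P? σ ⟧)
      ≡⟨ ΣWords-distinct n (λ σ → ⟦ P? σ ⟧) ⟩
    ΣPerm n (λ σ → ⟦ P? σ ⟧) ∎

  ⟦×⟧ : {P Q : Set} (p : Dec P) (q : Dec Q) → ⟦ p ×-dec q ⟧ ≡ ⟦ p ⟧ * ⟦ q ⟧
  ⟦×⟧ (yes _) (yes _) = refl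
  ⟦×⟧ (yes _) (no _) = refl
  ⟦×⟧ (no _) (yes _) = refl
  ⟦×⟧ (no _) (no _) = refl

  #InvDesc∩Desc≡ΣPerm : ∀ n (x y a b : Fin n) → + #InvDesc∩Desc x y a b ≡ ΣPerm n (λ σ → invDesc x y σ * desc a b σ)
  #InvDesc∩Desc≡ΣPerm n x y a b = trans (count≡ΣPerm n _)
    (ΣPerm-cong n (λ σ _ → ⟦×⟧ (inv σ y Fin.<? inv σ x) (lookup σ b Fin.<? lookup σ a)))

  complement : ∀ {a b} → a + b ≡ + 1 → b ≡ + 1 - a
  complement {a} {b} a+b≡1 = trans (cancel a b) (cong (_- a) a+b≡1)
    where cancel : ∀ a b → b ≡ (a + b) - a
          cancel = solve-∀

  product-of-indicators : ∀ i i′ d d′ → i + i′ ≡ + 1 → d + d′ ≡ + 1 →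
      (+ 4 * (i * d) ≡ + 1 + (i - i′) + + 1 * (d - d′) + + 1 * ((d - d′) * (i - i′)))
    × (+ 4 * (i * d′) ≡ + 1 + (i - i′) + - + 1 * (d - d′) + - + 1 * ((d - d′) * (i - i′)))
  product-of-indicators i i′ d d′ i+i′≡1 d+d′≡1 with complement {i} i+i′≡1 | complement {d} d+d′≡1
  ... | refl | refl = same-order i d , opposite-order i d
    where
    same-order : ∀ i d → + 4 * (i * d) ≡ + 1 + (i - (+ 1 - i)) + + 1 * (d - (+ 1 - d))
                                          + + 1 * ((d - (+ 1 - d)) * (i - (+ 1 - i)))
    same-order = solve-∀
    opposite-order : ∀ i d → + 4 * (i * (+ 1 - d)) ≡ + 1 + (i - (+ 1 - i)) + - + 1 * (d - (+ 1 - d))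
                                                     + - + 1 * ((d - (+ 1 - d)) * (i - (+ 1 - i)))
    opposite-order = solve-∀

  -- Summing 1 + s + ε·e + ε·e·s over 𝒮ₙ: the linear terms vanish, leaving n! + ε·Σ e·s.
  ΣPerm-expansion : ∀ n (x y a b : Fin n) → x ≢ y → a Fin.< b → ∀ ε →
    ΣPerm n (λ σ → + 1 + invSgn x y σ + ε * sgn a b σ + ε * (sgn a b σ * invSgn x y σ))
      ≡ fac n + ε * ΣPerm n (λ σ → sgn a b σ * invSgn x y σ)
  ΣPerm-expansion n x y a b x≢y a<b ε = begin
    ΣPerm n (λ σ → + 1 + s σ + ε * e σ + ε * (e σ * s σ))
      ≡⟨ ΣPerm-+ n (λ σ → + 1 + s σ + ε * e σ) (λ σ → ε * (e σ * s σ)) ⟩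
    ΣPerm n (λ σ → + 1 + s σ + ε * e σ) + ΣPerm n (λ σ → ε * (e σ * s σ))
      ≡⟨ cong₂ _+_ (ΣPerm-+ n (λ σ → + 1 + s σ) (λ σ → ε * e σ)) (ΣPerm-scale n ε (λ σ → e σ * s σ)) ⟩
    ΣPerm n (λ σ → + 1 + s σ) + ΣPerm n (λ σ → ε * e σ) + ε * D
      ≡⟨ cong₂ (λ p q → p + q + ε * D) (ΣPerm-+ n (λ _ → + 1) s) (ΣPerm-scale n ε e) ⟩
    ΣPerm n (λ _ → + 1) + ΣPerm n s + ε * ΣPerm n e + ε * D
      ≡⟨ cong₂ (λ p q → ΣPerm n (λ _ → + 1) + p + ε * q + ε * D) (ΣPerm-invSgn n x y x≢y) (ΣPerm-sgn n a b a<b) ⟩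
    ΣPerm n (λ _ → + 1) + + 0 + ε * + 0 + ε * D
      ≡⟨ cong (λ p → p + + 0 + ε * + 0 + ε * D) (trans (ΣPerm-const n (+ 1)) (ℤP.*-identityˡ (fac n))) ⟩
    fac n + + 0 + ε * + 0 + ε * D
      ≡⟨ drop-zeros (fac n) ε D ⟩
    fac n + ε * D ∎
    where
    s = invSgn x y
    e = sgn a b
    D = ΣPerm n (λ σ → e σ * s σ)
    drop-zeros : ∀ f ε d → f + + 0 + ε * + 0 + ε * d ≡ f + ε * d
    drop-zeros = solve-∀

  four-times-counts : ∀ n (x y a b : Fin n) → x Fin.< y → a Fin.< b →
      (+ 4 * + #InvDesc∩Desc x y a b ≡ fac n + + 1 * ΣPerm n (λ σ → sgn a b σ * invSgn x y σ))
    × (+ 4 * + #InvDesc∩Desc x y b a ≡ fac n + - + 1 * ΣPerm n (λ σ → sgn a b σ * invSgn x y σ))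
  four-times-counts n x y a b x<y a<b =
    via a b (+ 1) (λ σ σ-perm → proj₁ (pointwise σ σ-perm)) , via b a (- + 1) (λ σ σ-perm → proj₂ (pointwise σ σ-perm))
    where
    s = invSgn x y
    e = sgn a b
    pointwise : ∀ σ → IsPerm σ →
        (+ 4 * (invDesc x y σ * desc a b σ) ≡ + 1 + s σ + + 1 * e σ + + 1 * (e σ * s σ))
      × (+ 4 * (invDesc x y σ * desc b a σ) ≡ + 1 + s σ + - + 1 * e σ + - + 1 * (e σ * s σ))
    pointwise σ σ-perm = product-of-indicators (invDesc x y σ) (invDesc y x σ) (desc a b σ) (desc b a σ)
      (invDesc-compl σ σ-perm x y (FinP.<⇒≢ x<y)) (desc-compl σ σ-perm a b (FinP.<⇒≢ a<b))
    via : ∀ p q ε → (∀ σ → IsPerm σ → + 4 * (invDesc x y σ * desc p q σ) ≡ + 1 + s σ + ε * e σ + ε * (e σ * s σ)) →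
      + 4 * + #InvDesc∩Desc x y p q ≡ fac n + ε * ΣPerm n (λ σ → e σ * s σ)
    via p q ε pw = begin
      + 4 * + #InvDesc∩Desc x y p q                     ≡⟨ cong (+ 4 *_) (#InvDesc∩Desc≡ΣPerm n x y p q) ⟩
      + 4 * ΣPerm n (λ σ → invDesc x y σ * desc p q σ)  ≡⟨ ΣPerm-scale n (+ 4) (λ σ → invDesc x y σ * desc p q σ) ⟨
      ΣPerm n (λ σ → + 4 * (invDesc x y σ * desc p q σ)) ≡⟨ ΣPerm-cong n pw ⟩
      ΣPerm n (λ σ → + 1 + s σ + ε * e σ + ε * (e σ * s σ)) ≡⟨ ΣPerm-expansion n x y a b (FinP.<⇒≢ x<y) a<b ε ⟩
      fac n + ε * ΣPerm n (λ σ → e σ * s σ)             ∎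

  +-∸ : ∀ {m n} → n ℕ.≤ m → + (m ∸ n) ≡ + m - + n
  +-∸ {m} {n} n≤m = trans (sym (ℤP.⊖-≥ n≤m)) (sym (ℤP.m-n≡m⊖n m n))

  cleared-identities : ∀ n → 4 ℕ.≤ n → (i₁ j₁ i₂ j₂ : Fin n) → i₁ Fin.< j₁ → i₂ Fin.< j₂ →
      (+ 4 * + #InvDesc∩Desc i₁ j₁ i₂ j₂
         ≡ + 4 * + ((n ∸ 3) ! ℕ.* χ i₁ j₁ ℕ.* χ i₂ j₂) + + ((n ∸ 2) ! ℕ.* (n ℕ.* n ∸ n ℕ.+ 2)))
    × (+ 4 * + #InvDesc∩Desc i₁ j₁ j₂ i₂ + + 4 * + ((n ∸ 3) ! ℕ.* χ i₁ j₁ ℕ.* χ i₂ j₂)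
         ≡ + ((n ∸ 2) ! ℕ.* (n ℕ.* n ∸ n ∸ 2)))
  cleared-identities n@(suc (suc (suc (suc k)))) _ i₁ j₁ i₂ j₂ i₁<j₁ i₂<j₂ = sum-identity , difference-identity
    where
    N = + n
    F₂ = fac (n ∸ 2)
    F₃ = fac (n ∸ 3)
    X₁ = + χ i₁ j₁
    X₂ = + χ i₂ j₂
    P = (n ∸ 3) ! ℕ.* χ i₁ j₁ ℕ.* χ i₂ j₂
    R = (n ∸ 2) ! ℕ.* (n ℕ.* n ∸ n ℕ.+ 2)
    R′ = (n ∸ 2) ! ℕ.* (n ℕ.* n ∸ n ∸ 2)
    D = ΣPerm n (λ σ → sgn i₂ j₂ σ * invSgn i₁ j₁ σ)
    counts = four-times-counts n i₁ j₁ i₂ j₂ i₁<j₁ i₂<j₂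
    correlation : D ≡ + 2 * F₂ + + 4 * X₁ * X₂ * F₃
    correlation = ΣPerm-sgn-invSgn n i₂ j₂ i₁ j₁ i₂<j₂ i₁<j₁
    fac-n : fac n ≡ N * ((N - + 1) * F₂)
    fac-n = trans (fac-suc (suc (suc (suc k)))) (cong (N *_) (fac-suc (suc (suc k))))
    n²-n : + (n ℕ.* n ∸ n) ≡ N * N - N
    n²-n = trans (+-∸ (ℕP.m≤m*n n n)) (cong (_- N) (ℤP.pos-* n n))
    2≤n²-n : 2 ℕ.≤ n ℕ.* n ∸ n
    2≤n²-n = subst (2 ℕ.≤_) (sym (ℕP.m+n∸m≡n n (suc (suc (suc k)) ℕ.* n))) (ℕP.≤-trans (s≤s (s≤s z≤n)) (ℕP.m≤m+n n _))
    P≡ : + P ≡ F₃ * X₁ * X₂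
    P≡ = trans (ℤP.pos-* ((n ∸ 3) ! ℕ.* χ i₁ j₁) (χ i₂ j₂)) (cong (_* X₂) (ℤP.pos-* ((n ∸ 3) !) (χ i₁ j₁)))
    R≡ : + R ≡ F₂ * (N * N - N + + 2)
    R≡ = trans (ℤP.pos-* ((n ∸ 2) !) (n ℕ.* n ∸ n ℕ.+ 2))
               (cong (F₂ *_) (trans (ℤP.pos-+ (n ℕ.* n ∸ n) 2) (cong (_+ + 2) n²-n)))
    R′≡ : + R′ ≡ F₂ * (N * N - N - + 2)
    R′≡ = trans (ℤP.pos-* ((n ∸ 2) !) (n ℕ.* n ∸ n ∸ 2))
                (cong (F₂ *_) (trans (+-∸ 2≤n²-n) (cong (_- + 2) n²-n)))
    sum-form : ∀ n f₂ f₃ x₁ x₂ → n * ((n - + 1) * f₂) + + 1 * (+ 2 * f₂ + + 4 * x₁ * x₂ * f₃)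
                                   ≡ + 4 * (f₃ * x₁ * x₂) + f₂ * (n * n - n + + 2)
    sum-form = solve-∀
    difference-form : ∀ n f₂ f₃ x₁ x₂ → n * ((n - + 1) * f₂) + - + 1 * (+ 2 * f₂ + + 4 * x₁ * x₂ * f₃)
                                          + + 4 * (f₃ * x₁ * x₂) ≡ f₂ * (n * n - n - + 2)
    difference-form = solve-∀
    sum-identity : + 4 * + #InvDesc∩Desc i₁ j₁ i₂ j₂ ≡ + 4 * + P + + R
    sum-identity = begin
      + 4 * + #InvDesc∩Desc i₁ j₁ i₂ j₂                ≡⟨ proj₁ counts ⟩
      fac n + + 1 * D                                  ≡⟨ cong₂ (λ f d → f + + 1 * d) fac-n correlation ⟩
      N * ((N - + 1) * F₂) + + 1 * (+ 2 * F₂ + + 4 * X₁ * X₂ * F₃) ≡⟨ sum-form N F₂ F₃ X₁ X₂ ⟩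
      + 4 * (F₃ * X₁ * X₂) + F₂ * (N * N - N + + 2)   ≡⟨ cong₂ (λ p r → + 4 * p + r) (sym P≡) (sym R≡) ⟩
      + 4 * + P + + R                                  ∎
    difference-identity : + 4 * + #InvDesc∩Desc i₁ j₁ j₂ i₂ + + 4 * + P ≡ + R′
    difference-identity = begin
      + 4 * + #InvDesc∩Desc i₁ j₁ j₂ i₂ + + 4 * + P    ≡⟨ cong₂ (λ b p → b + + 4 * p) (proj₂ counts) P≡ ⟩
      fac n + - + 1 * D + + 4 * (F₃ * X₁ * X₂)         ≡⟨ cong₂ (λ f d → f + - + 1 * d + + 4 * (F₃ * X₁ * X₂)) fac-n correlation ⟩
      N * ((N - + 1) * F₂) + - + 1 * (+ 2 * F₂ + + 4 * X₁ * X₂ * F₃) + + 4 * (F₃ * X₁ * X₂)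
                                                       ≡⟨ difference-form N F₂ F₃ X₁ X₂ ⟩
      F₂ * (N * N - N - + 2)                           ≡⟨ sym R′≡ ⟩
      + R′                                             ∎
  cleared-identities 1 (s≤s ()) _ _ _ _ _ _
  cleared-identities 2 (s≤s (s≤s ())) _ _ _ _ _ _
  cleared-identities 3 (s≤s (s≤s (s≤s ()))) _ _ _ _ _ _

  toℚᵘ-/ : ∀ i d → ℚ.toℚᵘ (i / suc d) ℚᵘ.≃ mkℚᵘ i d
  toℚᵘ-/ i d = ℚP.toℚᵘ-fromℚᵘ (mkℚᵘ i d)

  quarter-sum : ∀ a p r → + 4 * a ≡ + 4 * p + r → a / 1 ≡ p / 1 ℚ.+ r / 4
  quarter-sum a p r 4a≡4p+r = ℚP.toℚᵘ-injective (begin-≃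
    ℚ.toℚᵘ (a / 1)                       ≈⟨ toℚᵘ-/ a 0 ⟩
    mkℚᵘ a 0                             ≈⟨ *≡* (trans (ℤP.*-comm a (+ 4)) (trans 4a≡4p+r (cross p r))) ⟩
    mkℚᵘ p 0 ℚᵘ.+ mkℚᵘ r 3                ≈⟨ ℚᵘP.+-cong (toℚᵘ-/ p 0) (toℚᵘ-/ r 3) ⟨
    ℚ.toℚᵘ (p / 1) ℚᵘ.+ ℚ.toℚᵘ (r / 4)   ≈⟨ ℚP.toℚᵘ-homo-+ (p / 1) (r / 4) ⟨
    ℚ.toℚᵘ (p / 1 ℚ.+ r / 4)             ∎≃)
    where
    open ℚᵘP.≃-Reasoning using (step-≈-⟩; step-≈-⟨) renaming (begin_ to begin-≃_; _∎ to _∎≃)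
    cross : ∀ p r → + 4 * p + r ≡ (p * + 4 + r * + 1) * + 1
    cross = solve-∀

  quarter-difference : ∀ b p r → + 4 * b + + 4 * p ≡ r → b / 1 ≡ r / 4 ℚ.- p / 1
  quarter-difference b p r 4b+4p≡r = ℚP.toℚᵘ-injective (begin-≃
    ℚ.toℚᵘ (b / 1)                           ≈⟨ toℚᵘ-/ b 0 ⟩
    mkℚᵘ b 0                                 ≈⟨ *≡* (trans (isolate b p) (trans (cong (_- + 4 * p) 4b+4p≡r) (cross p r))) ⟩
    mkℚᵘ r 3 ℚᵘ.+ ℚᵘ.- mkℚᵘ p 0               ≈⟨ ℚᵘP.+-cong (toℚᵘ-/ r 3) (ℚᵘP.-‿cong (toℚᵘ-/ p 0)) ⟨
    ℚ.toℚᵘ (r / 4) ℚᵘ.+ ℚᵘ.- ℚ.toℚᵘ (p / 1)   ≈⟨ ℚᵘP.+-congʳ (ℚ.toℚᵘ (r / 4)) (ℚP.toℚᵘ-homo‿- (p / 1)) ⟨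
    ℚ.toℚᵘ (r / 4) ℚᵘ.+ ℚ.toℚᵘ (ℚ.- (p / 1))  ≈⟨ ℚP.toℚᵘ-homo-+ (r / 4) (ℚ.- (p / 1)) ⟨
    ℚ.toℚᵘ (r / 4 ℚ.- p / 1)                 ∎≃)
    where
    open ℚᵘP.≃-Reasoning using (step-≈-⟩; step-≈-⟨) renaming (begin_ to begin-≃_; _∎ to _∎≃)
    isolate : ∀ b p → b * + 4 ≡ (+ 4 * b + + 4 * p) - + 4 * p
    isolate = solve-∀
    cross : ∀ p r → r - + 4 * p ≡ (r * + 1 + - p * + 4) * + 1
    cross = solve-∀

open Development using (cleared-identities; quarter-sum; quarter-difference)

open import Data.Nat using (ℕ; _≤_; _∸_; _*_; _+_; _!)
open import Data.Fin using (Fin; _<_)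
open import Data.Integer using (+_; -_)
open import Data.Rational using (ℚ; _/_)
open import Data.Product using (_×_; _,_; proj₁; proj₂)
open import Relation.Binary.PropositionalEquality using (_≡_)

lemma4p2 : (n : ℕ) → 4 ≤ n → (i₁ j₁ i₂ j₂ : Fin n) → i₁ < j₁ → i₂ < j₂ →
    ((+ #InvDesc∩Desc i₁ j₁ i₂ j₂) / 1
      ≡ Data.Rational._+_ ((+ ((n ∸ 3) ! * χ i₁ j₁ * χ i₂ j₂)) / 1)
                          ((+ ((n ∸ 2) ! * (n * n ∸ n + 2))) / 4))
    × ((+ #InvDesc∩Desc i₁ j₁ j₂ i₂) / 1
      ≡ Data.Rational._-_ ((+ ((n ∸ 2) ! * (n * n ∸ n ∸ 2))) / 4)
                          ((+ ((n ∸ 3) ! * χ i₁ j₁ * χ i₂ j₂)) / 1))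
lemma4p2 n 4≤n i₁ j₁ i₂ j₂ i₁<j₁ i₂<j₂ =
    quarter-sum (+ A) (+ P) (+ R) (proj₁ cleared)
  , quarter-difference (+ B) (+ P) (+ R′) (proj₂ cleared)
  where
  A = #InvDesc∩Desc i₁ j₁ i₂ j₂
  B = #InvDesc∩Desc i₁ j₁ j₂ i₂
  P = (n ∸ 3) ! * χ i₁ j₁ * χ i₂ j₂
  R = (n ∸ 2) ! * (n * n ∸ n + 2)
  R′ = (n ∸ 2) ! * (n * n ∸ n ∸ 2)
  cleared = cleared-identities n 4≤n i₁ j₁ i₂ j₂ i₁<j₁ i₂<j₂
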